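{- Let $q$ be a prime power with $q\equiv 1\pmod 4$. The Paley graph $P_q$ is separating if and only if $q$ is not a perfect square.
   Context: $P_q$ has vertex set $\mathbb{F}_q$, with $x,y$ adjacent if $x-y$ is a nonzero square in $\mathbb{F}_q$. A graph $\Gamma$ is separating if $\omega(\Gamma)\alpha(\Gamma)<|V(\Gamma)|$, where $\omega$ and $\alpha$ are the maximum clique and coclique sizes. -}

module Defs where

open import Level using (0ℓ)
open import Data.Nat using (ℕ; _*_; _<_; _≤_)
open import Data.Fin using (Fin)
open import Data.Fin.Subset using (Subset; _∈_; ∣_∣)
open import Data.Product using (Σ; ∃; ∃-syntax; _×_)
open import Relation.Nullary using (¬_)
open import Relation.Binary.PropositionalEquality using (_≡_; _≢_)
open import Algebra.Structures using (IsCommutativeRing)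

-- Any finite
-- field of order q is isomorphic to one of these, and F_q is unique up to
-- isomorphism, so quantifying over all such structures is the same as
-- talking about "the" field F_q.
record FieldOn (q : ℕ) : Set where
  infixl 7 _·_
  infixl 6 _⊕_
  field
    _⊕_  : Fin q → Fin q → Fin q
    _·_  : Fin q → Fin q → Fin q
    ⊖_   : Fin q → Fin q
    𝟘 𝟙  : Fin q
    isCommutativeRing : IsCommutativeRing _≡_ _⊕_ _·_ ⊖_ 𝟘 𝟙
    𝟙≢𝟘  : 𝟙 ≢ 𝟘
    inverse : ∀ x → x ≢ 𝟘 → ∃[ y ] (x · y ≡ 𝟙)

  _⊝_ : Fin q → Fin q → Fin q
  x ⊝ y = x ⊕ (⊖ y)

record Graph (n : ℕ) : Set₁ where
  field
    Adj : Fin n → Fin n → Set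

module _ {n : ℕ} (Γ : Graph n) where
  open Graph Γ

  IsClique : Subset n → Set
  IsClique S = ∀ x y → x ∈ S → y ∈ S → x ≢ y → Adj x y

  IsCoclique : Subset n → Set
  IsCoclique S = ∀ x y → x ∈ S → y ∈ S → x ≢ y → ¬ Adj x y

  IsCliqueNumber : ℕ → Set
  IsCliqueNumber k = (∃[ S ] (IsClique S × ∣ S ∣ ≡ k)) × (∀ S → IsClique S → ∣ S ∣ ≤ k)

  IsCocliqueNumber : ℕ → Set
  IsCocliqueNumber k = (∃[ S ] (IsCoclique S × ∣ S ∣ ≡ k)) × (∀ S → IsCoclique S → ∣ S ∣ ≤ k)

  Separating : Set
  Separating = ∃[ ω ] ∃[ α ] (IsCliqueNumber ω × IsCocliqueNumber α × ω * α < n)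

Paley : {q : ℕ} → FieldOn q → Graph q
Paley {q} F = record { Adj = λ x y → (x ⊝ y ≢ 𝟘) × (∃[ z ] (z · z ≡ x ⊝ y)) }
  where open FieldOn F

IsPerfectSquare : ℕ → Set
IsPerfectSquare q = ∃[ m ] (m * m ≡ q)

module Submission where

open import Defs
open import Data.Nat using (ℕ; suc; _*_; _%_; NonZero)
import Data.Nat as ℕ
open import Data.Nat.Primality using (Prime)
open import Data.Product using (∃-syntax)
open import Relation.Nullary using (¬_; Dec)
open import Relation.Binary.PropositionalEquality using (_≡_; _≢_)
open import Function.Bundles using (_⇔_; mk⇔)

-- Write ω and α for the clique and coclique numbers of P_q. Multiplying by a fixed nonsquare
-- turns cliques into cocliques and back, so ω = α; and for a clique C and a coclique A the
-- translates a + C (a ∈ A) are pairwise disjoint, so ωα ≤ q. Hence P_q is separating as soon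
-- as ω² ≠ q, in particular when q is not a square. If q = m², then m is a power of the
-- characteristic, x ↦ xᵐ is additive, and its fixed points form a subfield K with |K| ≥ m
-- (each fibre of x ↦ xᵐ − x is a coset of K, and there are at most m values). A nonzero
-- d ∈ K has d^(m−1) = 1, and m − 1 divides (q − 1)/2 because m is odd, so by Euler's
-- criterion K is a clique and ωα ≥ m² = q.

module Arithmetic where

  open import Data.Nat as ℕ using (zero; suc; _+_; _*_; _/_; _<_; _∸_; _!; s≤s; NonZero)
  open import Data.Nat.Properties as ℕ using (_!*_!≢0)
  open import Data.Nat.DivMod using (m≡m%n+[m/n]*n; m%n<n; m/n*n≡m; m∣n⇒o%n%m≡o%m; %-distribˡ-*)
  open import Data.Nat.Divisibility using (_∣_; divides; ∣⇒≤; m∣m*n; ∣1⇒≡1; _∣?_; *-cancelʳ-∣)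
  open import Data.Nat.Primality using (euclidsLemma; prime⇒nonTrivial; prime⇒nonZero; prime⇒irreducible)
  open import Data.Nat.Coprimality using (Coprime; coprime-divisor)
  open import Data.Nat.Combinatorics using (_C_; k![n∸k]!∣n!)
  open import Data.Nat.Combinatorics.Specification using (nCk≡n!/k![n-k]!)
  open import Data.Product using (∃-syntax; _,_)
  open import Data.Sum using (inj₁; inj₂)
  open import Data.Empty using (⊥-elim)
  open import Relation.Nullary using (yes; no)
  open import Relation.Binary.PropositionalEquality using (_≢_; refl; sym; trans; cong; cong₂; subst)

  p∤n! : ∀ {p n} → Prime p → n < p → ¬ (p ∣ n !)
  p∤n! {p} {zero}  p-prime _   p∣1 = ℕ.<-irrefl refl (ℕ.<-≤-trans (ℕ.nonTrivial⇒n>1 p {{prime⇒nonTrivial p-prime}}) (∣⇒≤ p∣1))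
  p∤n! {p} {suc n} p-prime n<p p∣n! with euclidsLemma (suc n) (n !) p-prime p∣n!
  ... | inj₁ p∣1+n = ℕ.<-irrefl refl (ℕ.≤-<-trans (∣⇒≤ p∣1+n) n<p)
  ... | inj₂ p∣n!  = p∤n! p-prime (ℕ.<-trans (ℕ.n<1+n n) n<p) p∣n!

  n∣n! : ∀ {n} → .{{NonZero n}} → n ∣ n !
  n∣n! {suc n} = m∣m*n (n !)

  -- p divides p! = C(p,k) · k! · (p − k)! but neither factorial.
  p∣pCk : ∀ {p k} → Prime p → 0 < k → k < p → p ∣ p C k
  p∣pCk {p} {k} p-prime 0<k k<p with euclidsLemma (p C k) (k ! * (p ∸ k) !) p-prime p∣pCk*k!*[p∸k]!
    where
    instance _ = k !* (p ∸ k) !≢0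
    p∣pCk*k!*[p∸k]! : p ∣ (p C k) * (k ! * (p ∸ k) !)
    p∣pCk*k!*[p∸k]! = subst (p ∣_) (sym pCk*k!*[p∸k]!≡p!) (n∣n! {{prime⇒nonZero p-prime}})
      where
      pCk*k!*[p∸k]!≡p! : (p C k) * (k ! * (p ∸ k) !) ≡ p !
      pCk*k!*[p∸k]!≡p! = trans (cong (_* (k ! * (p ∸ k) !)) (nCk≡n!/k![n-k]! (ℕ.<⇒≤ k<p))) (m/n*n≡m (k![n∸k]!∣n! (ℕ.<⇒≤ k<p)))
  ... | inj₁ p∣pCk = p∣pCk
  ... | inj₂ p∣k!*[p∸k]! with euclidsLemma (k !) ((p ∸ k) !) p-prime p∣k!*[p∸k]!
  ...   | inj₁ p∣k!     = ⊥-elim (p∤n! p-prime k<p p∣k!)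
  ...   | inj₂ p∣[p∸k]! = ⊥-elim (p∤n! p-prime (ℕ.∸-monoʳ-< 0<k (ℕ.<⇒≤ k<p)) p∣[p∸k]!)

  divisor-of-prime-power : ∀ {p} → Prime p → ∀ n d → d ∣ p ℕ.^ n → ∃[ j ] (d ≡ p ℕ.^ j)
  divisor-of-prime-power p-prime zero    d d∣1 = 0 , ∣1⇒≡1 d∣1
  divisor-of-prime-power {p} p-prime (suc n) d d∣pⁿ⁺¹ with p ∣? d
  ... | yes (divides c refl)
    with divisor-of-prime-power p-prime n c
           (*-cancelʳ-∣ p {{prime⇒nonZero p-prime}} (subst (c * p ∣_) (ℕ.*-comm p (p ℕ.^ n)) d∣pⁿ⁺¹))
  ...   | j , refl = suc j , ℕ.*-comm (p ℕ.^ j) p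
  divisor-of-prime-power {p} p-prime (suc n) d d∣pⁿ⁺¹ | no p∤d = divisor-of-prime-power p-prime n d (coprime-divisor d⊥p d∣pⁿ⁺¹)
    where
    d⊥p : Coprime d p
    d⊥p (c∣d , c∣p) with prime⇒irreducible p-prime c∣p
    ... | inj₁ c≡1 = c≡1
    ... | inj₂ refl = ⊥-elim (p∤d c∣d)

  odd⇒≡1+2* : ∀ m → m % 2 ≡ 1 → m ≡ suc (2 * (m / 2))
  odd⇒≡1+2* m m%2≡1 = trans (m≡m%n+[m/n]*n m 2) (cong₂ _+_ m%2≡1 (ℕ.*-comm (m / 2) 2))

  square-odd⇒odd : ∀ m → (m * m) % 2 ≡ 1 → m % 2 ≡ 1
  square-odd⇒odd m m²%2≡1 with m % 2 | m%n<n m 2 | %-distribˡ-* m m 2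
  ... | 1 | _ | _ = refl
  ... | 0 | _ | m²%2≡0 = ⊥-elim (0≢1 (trans (sym m²%2≡0) m²%2≡1))
    where
    0≢1 : 0 ≢ 1
    0≢1 ()
  ... | suc (suc _) | s≤s (s≤s ()) | _

  q%4≡1⇒q%2≡1 : ∀ q → q % 4 ≡ 1 → q % 2 ≡ 1
  q%4≡1⇒q%2≡1 q q%4≡1 = trans (sym (m∣n⇒o%n%m≡o%m 2 4 q (divides 2 refl))) (cong (_% 2) q%4≡1)

module Counting where

  open import Level using (Level)
  open import Data.Nat as ℕ using (ℕ; zero; suc; _+_; _*_; _≤_; _<_; z≤n; s≤s)
  open import Data.Nat.Properties as ℕ
    using (+-*-semiring; ≤-trans; ≤-reflexive; ≤-antisym; <-irrefl; <-≤-trans; +-mono-≤; +-mono-<-≤; +-mono-≤-<;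
           *-identityʳ; *-zeroʳ; +-identityʳ)
  open import Data.Fin using (Fin; zero; suc; _≟_)
  open import Data.Fin.Properties using (any?; suc-injective)
  open import Data.Fin.Permutation using (permutation)
  open import Data.Fin.Subset using (Subset; _∈_; ∣_∣; inside; outside; ⊥)
  open import Data.Fin.Subset.Properties using (_∈?_; anySubset?; ∣p∣≤n)
  open import Data.Vec using ([]; _∷_; tabulate; here; there)
  open import Data.Product using (∃-syntax; _×_; _,_; proj₁; proj₂)
  open import Data.Empty using (⊥-elim)
  open import Relation.Nullary using (¬_; Dec; yes; no; does; ¬?)
  open import Relation.Nullary.Decidable using (_×-dec_; _⊎-dec_; map′)
  open import Relation.Unary using (Pred; Decidable)
  open import Relation.Binary.PropositionalEquality using (_≡_; _≢_; refl; sym; trans; cong; module ≡-Reasoning)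
  open import Function using (_∘_)

  open import Algebra.Properties.Semiring.Sum +-*-semiring public
    using (sum; sum-cong-≗; ∑-distrib-+; ∑-comm; *-distribˡ-sum; sum-permute)

  private variable
    a b p r ℓ : Level
    A B : Set a
    n m : ℕ

  sum-mono : {f g : Fin n → ℕ} → (∀ x → f x ≤ g x) → sum f ≤ sum g
  sum-mono {zero}  f≤g = z≤n
  sum-mono {suc n} f≤g = +-mono-≤ (f≤g zero) (sum-mono (f≤g ∘ suc))

  sum-mono-< : {f g : Fin n → ℕ} → (∀ x → f x ≤ g x) → (y : Fin n) → f y < g y → sum f < sum g
  sum-mono-< {suc n} f≤g zero    f<g = +-mono-<-≤ f<g (sum-mono (f≤g ∘ suc))
  sum-mono-< {suc n} f≤g (suc y) f<g = +-mono-≤-< (f≤g zero) (sum-mono-< (f≤g ∘ suc) y f<g)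

  sum-const : (c : ℕ) → sum {n} (λ _ → c) ≡ n * c
  sum-const {zero}  c = refl
  sum-const {suc n} c = cong (c +_) (sum-const {n} c)

  sum-zero : {f : Fin n → ℕ} → (∀ x → f x ≡ 0) → sum f ≡ 0
  sum-zero {n} f≡0 = trans (sum-cong-≗ f≡0) (trans (sum-const {n} 0) (*-zeroʳ n))

  sum-single : {f : Fin n → ℕ} (y : Fin n) → (∀ x → x ≢ y → f x ≡ 0) → sum f ≡ f y
  sum-single {suc n} {f} zero    f≡0 =
    trans (cong (f zero +_) (sum-zero (λ x → f≡0 (suc x) λ ()))) (+-identityʳ _)
  sum-single {suc n} {f} (suc y) f≡0 =
    trans (cong (_+ sum (f ∘ suc)) (f≡0 zero λ ())) (sum-single y (λ x x≢y → f≡0 (suc x) (x≢y ∘ suc-injective)))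

  indicator : Dec A → ℕ
  indicator (yes _) = 1
  indicator (no  _) = 0

  indicator≤1 : (A? : Dec A) → indicator A? ≤ 1
  indicator≤1 (yes _) = s≤s z≤n
  indicator≤1 (no  _) = z≤n

  indicator-yes : (A? : Dec A) → A → indicator A? ≡ 1
  indicator-yes (yes _) _ = refl
  indicator-yes (no ¬a) a = ⊥-elim (¬a a)

  indicator-no : (A? : Dec A) → ¬ A → indicator A? ≡ 0
  indicator-no (yes a) ¬a = ⊥-elim (¬a a)
  indicator-no (no  _) _  = refl

  indicator-mono : (A? : Dec A) (B? : Dec B) → (A → B) → indicator A? ≤ indicator B?
  indicator-mono (yes a) (yes _) _   = s≤s z≤n
  indicator-mono (yes a) (no ¬b) a→b = ⊥-elim (¬b (a→b a))
  indicator-mono (no  _) _       _   = z≤n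

  count : {P : Pred (Fin n) p} → Decidable P → ℕ
  count P? = sum (λ x → indicator (P? x))

  module _ {P : Pred (Fin n) p} (P? : Decidable P) where

    count≤n : count P? ≤ n
    count≤n = ≤-trans (sum-mono (indicator≤1 ∘ P?)) (≤-reflexive (trans (sum-const {n} 1) (*-identityʳ n)))

    count-all : (∀ x → P x) → count P? ≡ n
    count-all all = trans (sum-cong-≗ (λ x → indicator-yes (P? x) (all x))) (trans (sum-const {n} 1) (*-identityʳ n))

    count-none : (∀ x → ¬ P x) → count P? ≡ 0
    count-none none = sum-zero (λ x → indicator-no (P? x) (none x))

    count-single : (y : Fin n) → (∀ x → P x → x ≡ y) → P y → count P? ≡ 1
    count-single y unique Py =
      trans (sum-single y (λ x x≢y → indicator-no (P? x) (x≢y ∘ unique x))) (indicator-yes (P? y) Py)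

    count-complement : count P? + count (¬? ∘ P?) ≡ n
    count-complement = begin
      count P? + count (¬? ∘ P?)                        ≡⟨ ∑-distrib-+ (indicator ∘ P?) (indicator ∘ ¬? ∘ P?) ⟨
      sum (λ x → indicator (P? x) + indicator (¬? (P? x))) ≡⟨ sum-cong-≗ (λ x → split (P? x)) ⟩
      sum {n} (λ _ → 1)                                   ≡⟨ sum-const {n} 1 ⟩
      n * 1                                               ≡⟨ *-identityʳ n ⟩
      n                                                   ∎
      where
      open ≡-Reasoning
      split : (A? : Dec A) → indicator A? + indicator (¬? A?) ≡ 1
      split (yes _) = refl
      split (no  _) = refl

  count-single-≟ : (y : Fin n) → count (_≟ y) ≡ 1
  count-single-≟ y = count-single (_≟ y) y (λ _ x≡y → x≡y) refl

  indicator-< : (A? : Dec A) (B? : Dec B) → ¬ A → B → indicator A? < indicator B?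
  indicator-< (yes a) _       ¬a _ = ⊥-elim (¬a a)
  indicator-< (no  _) (yes _) _  _ = s≤s z≤n
  indicator-< (no  _) (no ¬b) _  b = ⊥-elim (¬b b)

  indicator-map′ : {f : A → B} {g : B → A} (A? : Dec A) → indicator (map′ f g A?) ≡ indicator A?
  indicator-map′ (yes _) = refl
  indicator-map′ (no  _) = refl

  module _ {P : Pred (Fin n) p} {Q : Pred (Fin n) r} (P? : Decidable P) (Q? : Decidable Q) where

    count-mono : (∀ x → P x → Q x) → count P? ≤ count Q?
    count-mono P⊆Q = sum-mono (λ x → indicator-mono (P? x) (Q? x) (P⊆Q x))

    count-cong : (∀ x → P x → Q x) → (∀ x → Q x → P x) → count P? ≡ count Q?
    count-cong P⊆Q Q⊆P = ≤-antisym (count-mono P⊆Q) (sum-mono (λ x → indicator-mono (Q? x) (P? x) (Q⊆P x)))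

    ⊆∧count≥⇒⊇ : (∀ x → P x → Q x) → count Q? ≤ count P? → ∀ x → Q x → P x
    ⊆∧count≥⇒⊇ P⊆Q count≥ x Qx with P? x
    ... | yes Px = Px
    ... | no ¬Px = ⊥-elim (<-irrefl refl (<-≤-trans count< count≥))
      where
      count< : count P? < count Q?
      count< = sum-mono-< (λ y → indicator-mono (P? y) (Q? y) (P⊆Q y)) x (indicator-< (P? x) (Q? x) ¬Px Qx)

    count-∪ : count (λ x → P? x ⊎-dec Q? x) ≤ count P? + count Q?
    count-∪ = ≤-trans (sum-mono (λ x → union (P? x) (Q? x))) (≤-reflexive (∑-distrib-+ (indicator ∘ P?) (indicator ∘ Q?)))
      where
      union : (A? : Dec A) (B? : Dec B) → indicator (A? ⊎-dec B?) ≤ indicator A? + indicator B?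
      union (yes _) _       = s≤s z≤n
      union (no  _) (yes _) = s≤s z≤n
      union (no  _) (no  _) = z≤n

    count-∪-disjoint : (∀ x → P x → ¬ Q x) → count (λ x → P? x ⊎-dec Q? x) ≡ count P? + count Q?
    count-∪-disjoint disjoint = trans (sum-cong-≗ (λ x → union (P? x) (Q? x) (disjoint x)))
                                      (∑-distrib-+ (indicator ∘ P?) (indicator ∘ Q?))
      where
      union : (A? : Dec A) (B? : Dec B) → (A → ¬ B) → indicator (A? ⊎-dec B?) ≡ indicator A? + indicator B?
      union (yes a) (yes b) a→¬b = ⊥-elim (a→¬b a b)
      union (yes _) (no  _) _    = refl
      union (no  _) (yes _) _    = refl
      union (no  _) (no  _) _    = refl

    count-split : count P? ≡ count (λ x → P? x ×-dec Q? x) + count (λ x → P? x ×-dec ¬? (Q? x))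
    count-split = trans (sum-cong-≗ (λ x → split (P? x) (Q? x)))
                        (∑-distrib-+ (λ x → indicator (P? x ×-dec Q? x)) (λ x → indicator (P? x ×-dec ¬? (Q? x))))
      where
      split : (A? : Dec A) (B? : Dec B) → indicator A? ≡ indicator (A? ×-dec B?) + indicator (A? ×-dec ¬? B?)
      split (yes _) (yes _) = refl
      split (yes _) (no  _) = refl
      split (no  _) (yes _) = refl
      split (no  _) (no  _) = refl

  count-fibres : {P : Pred (Fin n) p} (P? : Decidable P) (h : Fin n → Fin m) →
                 count P? ≡ sum (λ y → count (λ x → P? x ×-dec (h x ≟ y)))
  count-fibres {n} {m} P? h =
    trans (sum-cong-≗ fibre) (∑-comm (λ x y → indicator (P? x ×-dec (h x ≟ y))))
    where
    fibre : ∀ x → indicator (P? x) ≡ sum (λ y → indicator (P? x ×-dec (h x ≟ y)))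
    fibre x with P? x
    ... | yes Px = sym (trans (sum-single (h x) (λ y hx≢y → indicator-no (yes Px ×-dec (h x ≟ y)) (hx≢y ∘ sym ∘ proj₂)))
                              (indicator-yes (yes Px ×-dec (h x ≟ h x)) (Px , refl)))
    ... | no ¬Px = sym (sum-zero (λ y → indicator-no (no ¬Px ×-dec (h x ≟ y)) (¬Px ∘ proj₁)))

  count-∃-disjoint : {R : Fin m → Pred (Fin n) r} (R? : ∀ i → Decidable (R i)) →
                     (∀ x i j → R i x → R j x → i ≡ j) →
                     count (λ x → any? (λ i → R? i x)) ≡ sum (λ i → count (R? i))
  count-∃-disjoint R? disjoint = trans (sum-cong-≗ split) (∑-comm (λ x i → indicator (R? i x)))
    where
    split : ∀ x → indicator (any? (λ i → R? i x)) ≡ sum (λ i → indicator (R? i x))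
    split x with any? (λ i → R? i x)
    ... | yes (i , Rix) = sym (trans (sum-single i (λ j j≢i → indicator-no (R? j x) (λ Rjx → j≢i (disjoint x j i Rjx Rix))))
                                     (indicator-yes (R? i x) Rix))
    ... | no ¬∃ = sym (sum-zero (λ i → indicator-no (R? i x) (λ Rix → ¬∃ (i , Rix))))

  count-∘-bijection : {P : Pred (Fin n) p} (P? : Decidable P) (f g : Fin n → Fin n) →
                      (∀ x → f (g x) ≡ x) → (∀ x → g (f x) ≡ x) → count (P? ∘ f) ≡ count P?
  count-∘-bijection P? f g fg gf = sym (sum-permute (indicator ∘ P?) (permutation f g fg gf))

  card≡count : (S : Subset n) → ∣ S ∣ ≡ count (_∈? S)
  card≡count []            = refl
  card≡count (inside  ∷ S) = cong suc (trans (card≡count S) (sum-cong-≗ (λ x → sym (indicator-map′ (x ∈? S)))))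
  card≡count (outside ∷ S) = trans (card≡count S) (sum-cong-≗ (λ x → sym (indicator-map′ (x ∈? S))))

  fromDec : {P : Pred (Fin n) ℓ} → Decidable P → Subset n
  fromDec P? = tabulate (does ∘ P?)

  ∈fromDec⇒ : {P : Pred (Fin n) ℓ} (P? : Decidable P) → ∀ x → x ∈ fromDec P? → P x
  ∈fromDec⇒ P? Fin.zero x∈ with P? Fin.zero
  ∈fromDec⇒ P? Fin.zero here | yes P0 = P0
  ∈fromDec⇒ P? Fin.zero () | no _
  ∈fromDec⇒ P? (Fin.suc x) (there x∈) = ∈fromDec⇒ (P? ∘ Fin.suc) x x∈

  ⇒∈fromDec : {P : Pred (Fin n) ℓ} (P? : Decidable P) → ∀ x → P x → x ∈ fromDec P?
  ⇒∈fromDec P? Fin.zero P0 with P? Fin.zero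
  ... | yes _ = here
  ... | no ¬P0 = ⊥-elim (¬P0 P0)
  ⇒∈fromDec P? (Fin.suc x) Px = there (⇒∈fromDec (P? ∘ Fin.suc) x Px)

  ∣fromDec∣ : {P : Pred (Fin n) ℓ} (P? : Decidable P) → ∣ fromDec P? ∣ ≡ count P?
  ∣fromDec∣ P? = trans (card≡count (fromDec P?)) (count-cong (_∈? fromDec P?) P? (∈fromDec⇒ P?) (⇒∈fromDec P?))

  maximum-exists : {Q : Pred (Subset n) ℓ} → Decidable Q → Q ⊥ →
                   ∃[ k ] ((∃[ S ] (Q S × ∣ S ∣ ≡ k)) × (∀ S → Q S → ∣ S ∣ ≤ k))
  maximum-exists {n} {Q = Q} Q? Q⊥ = descend n (λ S _ → ∣p∣≤n S)
    where
    descend : ∀ k → (∀ S → Q S → ∣ S ∣ ≤ k) → ∃[ k ] ((∃[ S ] (Q S × ∣ S ∣ ≡ k)) × (∀ S → Q S → ∣ S ∣ ≤ k))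
    descend k bound with anySubset? (λ S → Q? S ×-dec (∣ S ∣ ℕ.≟ k))
    ... | yes attained = k , attained , bound
    descend zero    bound | no ¬attained = ⊥-elim (¬attained (⊥ , Q⊥ , ℕ.n≤0⇒n≡0 (bound ⊥ Q⊥)))
    descend (suc k) bound | no ¬attained =
      descend k (λ S QS → ℕ.≤-pred (ℕ.≤∧≢⇒< (bound S QS) (λ ∣S∣≡k+1 → ¬attained (S , QS , ∣S∣≡k+1))))

module GraphProperties {n : ℕ} (Γ : Graph n) (Adj? : ∀ x y → Dec (Graph.Adj Γ x y)) where

  open import Data.Fin using (_≟_)
  open import Data.Fin.Properties using (all?)
  open import Data.Fin.Subset.Properties using (_∈?_; ∉⊥)
  open import Data.Product using (∃-syntax)
  open import Data.Empty using (⊥-elim)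
  open import Relation.Nullary using (¬?)
  open import Relation.Nullary.Decidable using (_→-dec_)
  open import Relation.Unary using (Decidable)
  open Counting using (maximum-exists)

  isClique? : Decidable (IsClique Γ)
  isClique? S = all? λ x → all? λ y → (x ∈? S) →-dec (y ∈? S) →-dec ¬? (x ≟ y) →-dec Adj? x y

  isCoclique? : Decidable (IsCoclique Γ)
  isCoclique? S = all? λ x → all? λ y → (x ∈? S) →-dec (y ∈? S) →-dec ¬? (x ≟ y) →-dec ¬? (Adj? x y)

  cliqueNumber-exists : ∃[ ω ] IsCliqueNumber Γ ω
  cliqueNumber-exists = maximum-exists isClique? (λ _ _ x∈⊥ → ⊥-elim (∉⊥ x∈⊥))

  cocliqueNumber-exists : ∃[ α ] IsCocliqueNumber Γ α
  cocliqueNumber-exists = maximum-exists isCoclique? (λ _ _ x∈⊥ → ⊥-elim (∉⊥ x∈⊥))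

module FieldProperties {q : ℕ} (F : FieldOn q) where

  open import Level using (0ℓ)
  open import Data.Nat as ℕ using (ℕ; zero; suc)
  import Data.Nat.Properties as ℕ
  open import Data.Nat.Divisibility using (_∣_; divides)
  open import Data.Integer as ℤ using (ℤ; +_; -[1+_]; _◃_)
  import Data.Integer.Properties as ℤ
  open import Data.Sign as Sign using (Sign)
  open import Data.Fin using (Fin; _≟_)
  open import Data.Maybe using (map)
  open import Data.Product using (_,_; proj₁; proj₂)
  open import Data.Sum using (_⊎_; inj₁; inj₂; [_,_]′)
  open import Function using (_∘_)
  open import Relation.Nullary using (yes; no)
  open import Relation.Nullary.Decidable using (dec⇒maybe)
  open import Relation.Binary.PropositionalEquality
  open import Algebra.Bundles using (CommutativeRing; Semiring)
  open import Algebra.Solver.Ring.AlmostCommutativeRing using (fromCommutativeRing; _-Raw-AlmostCommutative⟶_)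
  open import Relation.Unary using (Pred; Decidable)
  open Counting using (count; count-∘-bijection)

  open FieldOn F public
  open ≡-Reasoning

  commutativeRing : CommutativeRing 0ℓ 0ℓ
  commutativeRing = record { isCommutativeRing = isCommutativeRing }

  open CommutativeRing commutativeRing public
    using (+-assoc; +-comm; +-identityˡ; +-identityʳ; -‿inverseˡ; -‿inverseʳ;
           *-assoc; *-comm; *-identityˡ; *-identityʳ; zeroˡ; zeroʳ;
           ring; semiring; commutativeSemiring; +-monoid; *-monoid; *-commutativeMonoid)
  open import Algebra.Properties.Ring ring public
    using (-‿distribˡ-*; -‿distribʳ-*; -‿involutive; -0#≈0#; -‿+-comm; -1*x≈-x)
  open import Algebra.Definitions.RawSemiring (Semiring.rawSemiring semiring) public
    using (_^_) renaming (_×_ to _⋆_)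
  open import Algebra.Properties.Semiring.Exp semiring public using (^-homo-*; ^-assocʳ)
  open import Algebra.Properties.CommutativeSemiring.Exp commutativeSemiring public using (^-distrib-*)
  open import Algebra.Properties.Monoid.Mult +-monoid using (×-homo-+)
  open import Algebra.Properties.Semiring.Mult semiring using (×1-homo-*; ×-assoc-*)

  infixl 6 _−_

  -- `_⊝_` from Defs carries no fixity declaration, so it binds tighter than `_·_`.
  _−_ : Fin q → Fin q → Fin q
  _−_ = _⊝_

  ι : ℕ → Fin q
  ι n = n ⋆ 𝟙

  ι-+ : ∀ m n → ι (m ℕ.+ n) ≡ ι m ⊕ ι n
  ι-+ = ×-homo-+ 𝟙

  ι-* : ∀ m n → ι (m ℕ.* n) ≡ ι m · ι n
  ι-* = ×1-homo-*

  ι-1 : ι 1 ≡ 𝟙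
  ι-1 = +-identityʳ 𝟙

  ι-∣ : ∀ {d n} → ι d ≡ 𝟘 → d ∣ n → ι n ≡ 𝟘
  ι-∣ {d} ιd≡𝟘 (divides c refl) = trans (ι-* c d) (trans (cong (ι c ·_) ιd≡𝟘) (zeroʳ (ι c)))

  ι·x≡ι⋆x : ∀ n x → ι n · x ≡ n ⋆ x
  ι·x≡ι⋆x n x = trans (×-assoc-* n 𝟙 x) (cong (n ⋆_) (*-identityˡ x))

  -- The ring solver normalises with integer coefficients, interpreted in the field by ⟦_⟧ℤ.
  ⟦_⟧ℤ : ℤ → Fin q
  ⟦ + n      ⟧ℤ = ι n
  ⟦ -[1+ n ] ⟧ℤ = ⊖ ι (suc n)

  private
    signed : Sign → Fin q → Fin q
    signed Sign.+ x = x
    signed Sign.- x = ⊖ x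

    ⟦⟧ℤ-signAbs : ∀ i → ⟦ i ⟧ℤ ≡ signed (ℤ.sign i) (ι ℤ.∣ i ∣)
    ⟦⟧ℤ-signAbs (+ n)      = refl
    ⟦⟧ℤ-signAbs -[1+ n ]   = refl

    ⟦◃⟧ℤ : ∀ s n → ⟦ s ◃ n ⟧ℤ ≡ signed s (ι n)
    ⟦◃⟧ℤ Sign.+ zero    = refl
    ⟦◃⟧ℤ Sign.- zero    = sym -0#≈0#
    ⟦◃⟧ℤ Sign.+ (suc n) = refl
    ⟦◃⟧ℤ Sign.- (suc n) = refl

    signed-* : ∀ s t x y → signed (s Sign.* t) (x · y) ≡ signed s x · signed t y
    signed-* Sign.+ Sign.+ x y = refl
    signed-* Sign.+ Sign.- x y = -‿distribʳ-* x y
    signed-* Sign.- Sign.+ x y = -‿distribˡ-* x y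
    signed-* Sign.- Sign.- x y = begin
      x · y         ≡⟨ -‿involutive (x · y) ⟨
      ⊖ ⊖ (x · y)   ≡⟨ cong ⊖_ (-‿distribˡ-* x y) ⟩
      ⊖ (⊖ x · y)   ≡⟨ -‿distribʳ-* (⊖ x) y ⟩
      ⊖ x · ⊖ y     ∎

    ι-suc−ι-suc : ∀ m n → ι (suc m) − ι (suc n) ≡ ι m − ι n
    ι-suc−ι-suc m n = begin
      (𝟙 ⊕ ι m) ⊕ ⊖ (𝟙 ⊕ ι n)     ≡⟨ cong ((𝟙 ⊕ ι m) ⊕_) (-‿+-comm 𝟙 (ι n)) ⟨
      (𝟙 ⊕ ι m) ⊕ (⊖ 𝟙 ⊕ ⊖ ι n)   ≡⟨ +-assoc 𝟙 (ι m) _ ⟩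
      𝟙 ⊕ (ι m ⊕ (⊖ 𝟙 ⊕ ⊖ ι n))   ≡⟨ cong (𝟙 ⊕_) (+-assoc (ι m) (⊖ 𝟙) _) ⟨
      𝟙 ⊕ ((ι m ⊕ ⊖ 𝟙) ⊕ ⊖ ι n)   ≡⟨ cong (λ z → 𝟙 ⊕ (z ⊕ ⊖ ι n)) (+-comm (ι m) (⊖ 𝟙)) ⟩
      𝟙 ⊕ ((⊖ 𝟙 ⊕ ι m) ⊕ ⊖ ι n)   ≡⟨ cong (𝟙 ⊕_) (+-assoc (⊖ 𝟙) (ι m) _) ⟩
      𝟙 ⊕ (⊖ 𝟙 ⊕ (ι m ⊕ ⊖ ι n))   ≡⟨ +-assoc 𝟙 (⊖ 𝟙) _ ⟨
      (𝟙 ⊕ ⊖ 𝟙) ⊕ (ι m ⊕ ⊖ ι n)   ≡⟨ cong (_⊕ (ι m ⊕ ⊖ ι n)) (-‿inverseʳ 𝟙) ⟩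
      𝟘 ⊕ (ι m ⊕ ⊖ ι n)           ≡⟨ +-identityˡ _ ⟩
      ι m ⊕ ⊖ ι n                 ∎

    ⟦⊖⟧ℤ : ∀ m n → ⟦ m ℤ.⊖ n ⟧ℤ ≡ ι m − ι n
    ⟦⊖⟧ℤ zero    zero    = sym (-‿inverseʳ 𝟘)
    ⟦⊖⟧ℤ (suc m) zero    = sym (trans (cong (ι (suc m) ⊕_) -0#≈0#) (+-identityʳ _))
    ⟦⊖⟧ℤ zero    (suc n) = sym (+-identityˡ _)
    ⟦⊖⟧ℤ (suc m) (suc n) =
      trans (cong ⟦_⟧ℤ (ℤ.[1+m]⊖[1+n]≡m⊖n m n)) (trans (⟦⊖⟧ℤ m n) (sym (ι-suc−ι-suc m n)))

    ⟦⟧ℤ-+ : ∀ i j → ⟦ i ℤ.+ j ⟧ℤ ≡ ⟦ i ⟧ℤ ⊕ ⟦ j ⟧ℤ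
    ⟦⟧ℤ-+ -[1+ m ] -[1+ n ] = begin
      ⊖ (𝟙 ⊕ ι (suc (m ℕ.+ n)))      ≡⟨ cong (λ k → ⊖ (𝟙 ⊕ ι k)) (ℕ.+-suc m n) ⟨
      ⊖ (𝟙 ⊕ ι (m ℕ.+ suc n))        ≡⟨ cong (λ x → ⊖ (𝟙 ⊕ x)) (ι-+ m (suc n)) ⟩
      ⊖ (𝟙 ⊕ (ι m ⊕ ι (suc n)))      ≡⟨ cong ⊖_ (+-assoc 𝟙 (ι m) _) ⟨
      ⊖ (ι (suc m) ⊕ ι (suc n))      ≡⟨ -‿+-comm _ _ ⟨
      ⊖ ι (suc m) ⊕ ⊖ ι (suc n)      ∎
    ⟦⟧ℤ-+ -[1+ m ] (+ n)    = trans (⟦⊖⟧ℤ n (suc m)) (+-comm (ι n) _)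
    ⟦⟧ℤ-+ (+ m)    -[1+ n ] = ⟦⊖⟧ℤ m (suc n)
    ⟦⟧ℤ-+ (+ m)    (+ n)    = ι-+ m n

    ⟦⟧ℤ-* : ∀ i j → ⟦ i ℤ.* j ⟧ℤ ≡ ⟦ i ⟧ℤ · ⟦ j ⟧ℤ
    ⟦⟧ℤ-* i j = begin
      ⟦ (sᵢ Sign.* sⱼ) ◃ (∣i∣ ℕ.* ∣j∣) ⟧ℤ         ≡⟨ ⟦◃⟧ℤ (sᵢ Sign.* sⱼ) (∣i∣ ℕ.* ∣j∣) ⟩
      signed (sᵢ Sign.* sⱼ) (ι (∣i∣ ℕ.* ∣j∣))    ≡⟨ cong (signed (sᵢ Sign.* sⱼ)) (ι-* ∣i∣ ∣j∣) ⟩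
      signed (sᵢ Sign.* sⱼ) (ι ∣i∣ · ι ∣j∣)      ≡⟨ signed-* sᵢ sⱼ _ _ ⟩
      signed sᵢ (ι ∣i∣) · signed sⱼ (ι ∣j∣)      ≡⟨ cong₂ _·_ (⟦⟧ℤ-signAbs i) (⟦⟧ℤ-signAbs j) ⟨
      ⟦ i ⟧ℤ · ⟦ j ⟧ℤ                           ∎
      where
      sᵢ = ℤ.sign i; sⱼ = ℤ.sign j; ∣i∣ = ℤ.∣ i ∣; ∣j∣ = ℤ.∣ j ∣

    ⟦⟧ℤ-neg : ∀ i → ⟦ ℤ.- i ⟧ℤ ≡ ⊖ ⟦ i ⟧ℤ
    ⟦⟧ℤ-neg (+ zero)  = sym -0#≈0#
    ⟦⟧ℤ-neg (+ suc n) = refl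
    ⟦⟧ℤ-neg -[1+ n ]  = sym (-‿involutive _)

  ⟦⟧ℤ-morphism : ℤ.+-*-rawRing -Raw-AlmostCommutative⟶ fromCommutativeRing commutativeRing
  ⟦⟧ℤ-morphism = record
    { ⟦_⟧ = ⟦_⟧ℤ ; +-homo = ⟦⟧ℤ-+ ; *-homo = ⟦⟧ℤ-* ; -‿homo = ⟦⟧ℤ-neg ; 0-homo = refl ; 1-homo = ι-1 }

  open import Algebra.Solver.Ring ℤ.+-*-rawRing (fromCommutativeRing commutativeRing) ⟦⟧ℤ-morphism
    (λ i j → map (cong ⟦_⟧ℤ) (dec⇒maybe (i ℤ.≟ j))) public
    using (solve; _:=_; _:+_; _:*_; :-_; _:-_; con)

  x−x≡𝟘 : ∀ x → x − x ≡ 𝟘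
  x−x≡𝟘 = -‿inverseʳ

  x−y≡𝟘⇒x≡y : ∀ {x y} → x − y ≡ 𝟘 → x ≡ y
  x−y≡𝟘⇒x≡y {x} {y} x−y≡𝟘 = begin
    x              ≡⟨ solve 2 (λ x y → x := (x :- y) :+ y) refl x y ⟩
    (x − y) ⊕ y    ≡⟨ cong (_⊕ y) x−y≡𝟘 ⟩
    𝟘 ⊕ y          ≡⟨ +-identityˡ y ⟩
    y              ∎

  x≢y⇒x−y≢𝟘 : ∀ {x y} → x ≢ y → x − y ≢ 𝟘
  x≢y⇒x−y≢𝟘 x≢y = x≢y ∘ x−y≡𝟘⇒x≡y

  x−y≡-[y−x] : ∀ x y → x − y ≡ ⊖ (y − x)
  x−y≡-[y−x] = solve 2 (λ x y → x :- y := :- (y :- x)) refl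

  inv : ∀ x → x ≢ 𝟘 → Fin q
  inv x x≢𝟘 = proj₁ (inverse x x≢𝟘)

  inverseʳ : ∀ x (x≢𝟘 : x ≢ 𝟘) → x · inv x x≢𝟘 ≡ 𝟙
  inverseʳ x x≢𝟘 = proj₂ (inverse x x≢𝟘)

  inverseˡ : ∀ x (x≢𝟘 : x ≢ 𝟘) → inv x x≢𝟘 · x ≡ 𝟙
  inverseˡ x x≢𝟘 = trans (*-comm _ x) (inverseʳ x x≢𝟘)

  inv-cancelˡ : ∀ x (x≢𝟘 : x ≢ 𝟘) y → inv x x≢𝟘 · (x · y) ≡ y
  inv-cancelˡ x x≢𝟘 y = trans (sym (*-assoc _ x y)) (trans (cong (_· y) (inverseˡ x x≢𝟘)) (*-identityˡ y))

  inv-cancelʳ : ∀ x (x≢𝟘 : x ≢ 𝟘) y → x · (inv x x≢𝟘 · y) ≡ y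
  inv-cancelʳ x x≢𝟘 y = trans (sym (*-assoc x _ y)) (trans (cong (_· y) (inverseʳ x x≢𝟘)) (*-identityˡ y))

  ·-cancelˡ : ∀ {x y z} → x ≢ 𝟘 → x · y ≡ x · z → y ≡ z
  ·-cancelˡ {x} {y} {z} x≢𝟘 xy≡xz = begin
    y                       ≡⟨ inv-cancelˡ x x≢𝟘 y ⟨
    inv x x≢𝟘 · (x · y)     ≡⟨ cong (inv x x≢𝟘 ·_) xy≡xz ⟩
    inv x x≢𝟘 · (x · z)     ≡⟨ inv-cancelˡ x x≢𝟘 z ⟩
    z                       ∎

  ·-cancelʳ : ∀ {x y z} → x ≢ 𝟘 → y · x ≡ z · x → y ≡ z
  ·-cancelʳ {x} {y} {z} x≢𝟘 yx≡zx = ·-cancelˡ x≢𝟘 (trans (*-comm x y) (trans yx≡zx (*-comm z x)))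

  x·y≡𝟘⇒x≡𝟘⊎y≡𝟘 : ∀ {x y} → x · y ≡ 𝟘 → x ≡ 𝟘 ⊎ y ≡ 𝟘
  x·y≡𝟘⇒x≡𝟘⊎y≡𝟘 {x} {y} xy≡𝟘 with x ≟ 𝟘
  ... | yes x≡𝟘 = inj₁ x≡𝟘
  ... | no  x≢𝟘 = inj₂ (·-cancelˡ x≢𝟘 (trans xy≡𝟘 (sym (zeroʳ x))))

  x≢𝟘∧y≢𝟘⇒x·y≢𝟘 : ∀ {x y} → x ≢ 𝟘 → y ≢ 𝟘 → x · y ≢ 𝟘
  x≢𝟘∧y≢𝟘⇒x·y≢𝟘 x≢𝟘 y≢𝟘 xy≡𝟘 = [ x≢𝟘 , y≢𝟘 ]′ (x·y≡𝟘⇒x≡𝟘⊎y≡𝟘 xy≡𝟘)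

  𝟙^n≡𝟙 : ∀ n → 𝟙 ^ n ≡ 𝟙
  𝟙^n≡𝟙 zero    = refl
  𝟙^n≡𝟙 (suc n) = trans (*-identityˡ _) (𝟙^n≡𝟙 n)

  module _ {ℓ} {P : Pred (Fin q) ℓ} (P? : Decidable P) where

    count-translate : ∀ c → count (λ x → P? (x − c)) ≡ count P?
    count-translate c = count-∘-bijection P? (_− c) (_⊕ c)
      (λ x → solve 2 (λ x c → (x :+ c) :- c := x) refl x c)
      (λ x → solve 2 (λ x c → (x :- c) :+ c := x) refl x c)

    count-scale : ∀ c → c ≢ 𝟘 → count (λ x → P? (c · x)) ≡ count P?
    count-scale c c≢𝟘 = count-∘-bijection P? (c ·_) (inv c c≢𝟘 ·_) (inv-cancelʳ c c≢𝟘) (inv-cancelˡ c c≢𝟘)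

module Characteristic {q : ℕ} (F : FieldOn q) where

  open import Data.Nat as ℕ using (ℕ; suc; _<_)
  import Data.Nat.Properties as ℕ
  open import Data.Nat.ListAction using (product)
  open import Data.Nat.Primality using (Prime)
  open import Data.Nat.Primality.Factorisation using (factorise; PrimeFactorisation)
  open import Data.Fin using (Fin; toℕ)
  open import Data.Fin.Properties using (pigeonhole)
  open import Data.List using ([]; _∷_)
  open import Data.List.Relation.Unary.All using (All; _∷_)
  open import Data.Product using (∃-syntax; _×_; _,_)
  open import Data.Sum using (inj₁; inj₂)
  open import Data.Empty using (⊥-elim)
  open import Relation.Binary.PropositionalEquality

  open FieldProperties F
  open ≡-Reasoning

  ι-vanishes : ∃[ n ] (0 < n × ι n ≡ 𝟘)
  ι-vanishes with pigeonhole (ℕ.n<1+n q) (λ (i : Fin (suc q)) → ι (toℕ i))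
  ... | i , j , i<j , ιi≡ιj = toℕ j ℕ.∸ toℕ i , ℕ.m<n⇒0<n∸m i<j , (begin
    ι d                       ≡⟨ solve 2 (λ a b → b := (a :+ b) :- a) refl (ι (toℕ i)) (ι d) ⟩
    (ι (toℕ i) ⊕ ι d) − ι (toℕ i)  ≡⟨ cong (_− ι (toℕ i)) (trans (sym (ι-+ (toℕ i) d)) (cong ι (ℕ.m+[n∸m]≡n (ℕ.<⇒≤ i<j)))) ⟩
    ι (toℕ j) − ι (toℕ i)     ≡⟨ cong (_− ι (toℕ i)) (sym ιi≡ιj) ⟩
    ι (toℕ i) − ι (toℕ i)     ≡⟨ x−x≡𝟘 _ ⟩
    𝟘                         ∎)
    where d = toℕ j ℕ.∸ toℕ i

  ι-product≡𝟘 : ∀ {ns} → All Prime ns → ι (product ns) ≡ 𝟘 → ∃[ p ] (Prime p × ι p ≡ 𝟘)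
  ι-product≡𝟘 {[]}     _          ι1≡𝟘  = ⊥-elim (𝟙≢𝟘 (trans (sym ι-1) ι1≡𝟘))
  ι-product≡𝟘 {n ∷ ns} (pn ∷ pns) ι*≡𝟘 with x·y≡𝟘⇒x≡𝟘⊎y≡𝟘 (trans (sym (ι-* n (product ns))) ι*≡𝟘)
  ... | inj₁ ιn≡𝟘 = n , pn , ιn≡𝟘
  ... | inj₂ ι∏≡𝟘 = ι-product≡𝟘 pns ι∏≡𝟘

  characteristic : ∃[ p ] (Prime p × ι p ≡ 𝟘)
  characteristic with ι-vanishes
  ... | suc n , _ , ιn≡𝟘 =
    ι-product≡𝟘 factorsPrime (trans (cong ι (sym isFactorisation)) ιn≡𝟘)
    where open PrimeFactorisation (factorise (suc n))

module PrimePowerOrder {q : ℕ} (F : FieldOn q) {p : ℕ} (p-prime : Prime p) (ιp≡𝟘 : FieldProperties.ι F p ≡ FieldOn.𝟘 F) where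

  open Counting
  open import Data.Nat as ℕ using (ℕ; zero; suc; _+_; _*_; _<_; _≤_; _∸_; NonZero; z≤n; >-nonZero)
  import Data.Nat.Properties as ℕ
  open import Data.Nat.DivMod using (_%_; _/_; m≡m%n+[m/n]*n; m%n<n)
  open import Data.Nat.Divisibility using (divides)
  open import Data.Nat.Primality using (Prime; prime⇒nonZero; prime⇒nonTrivial)
  open import Data.Nat.Coprimality using (prime⇒coprime; coprime-Bézout)
  open import Data.Nat.GCD using (module Bézout)
  open import Data.Fin using (Fin; toℕ; fromℕ<; _≟_)
  open import Data.Fin.Properties using (any?; toℕ-fromℕ<; toℕ-injective; toℕ<n)
  open import Data.Product using (∃-syntax; _×_; _,_)
  open import Data.Sum using (_⊎_; inj₁; inj₂)
  open import Data.Empty using (⊥; ⊥-elim)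
  open import Relation.Nullary using (¬_; yes; no; ¬?)
  open import Relation.Unary using (Decidable)
  open import Relation.Binary.Definitions using (tri<; tri≈; tri>)
  open import Relation.Binary.PropositionalEquality

  open FieldProperties F
  open ≡-Reasoning

  instance
    p≢0 : NonZero p
    p≢0 = prime⇒nonZero p-prime

  ι-multiple : ∀ n → ι (n * p) ≡ 𝟘
  ι-multiple n = ι-∣ ιp≡𝟘 (divides n refl)

  ι-mod : ∀ n → ι (n % p) ≡ ι n
  ι-mod n = sym (begin
    ι n                          ≡⟨ cong ι (m≡m%n+[m/n]*n n p) ⟩
    ι (n % p + n / p * p)        ≡⟨ ι-+ (n % p) _ ⟩
    ι (n % p) ⊕ ι (n / p * p)    ≡⟨ cong (ι (n % p) ⊕_) (ι-multiple (n / p)) ⟩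
    ι (n % p) ⊕ 𝟘                ≡⟨ +-identityʳ _ ⟩
    ι (n % p)                    ∎)

  ι[1+multiple]≡𝟙 : ∀ n → ι (1 + n * p) ≡ 𝟙
  ι[1+multiple]≡𝟙 n = trans (ι-+ 1 (n * p)) (trans (cong₂ _⊕_ ι-1 (ι-multiple n)) (+-identityʳ 𝟙))

  ι[p∸1]≡-𝟙 : ι (p ∸ 1) ≡ ⊖ 𝟙
  ι[p∸1]≡-𝟙 = begin
    ι (p ∸ 1)                  ≡⟨ solve 2 (λ x one → x := (one :+ x) :- one) refl (ι (p ∸ 1)) 𝟙 ⟩
    ι (1 + (p ∸ 1)) − 𝟙        ≡⟨ cong (λ n → ι n − 𝟙) (ℕ.m+[n∸m]≡n (ℕ.>-nonZero⁻¹ p)) ⟩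
    ι p − 𝟙                    ≡⟨ cong (_− 𝟙) ιp≡𝟘 ⟩
    𝟘 − 𝟙                      ≡⟨ +-identityˡ (⊖ 𝟙) ⟩
    ⊖ 𝟙                        ∎

  -- By Bézout, 1 + x p = y d or 1 + y d = x p; in the second case ι y · ι d = −1 and the
  -- sign is absorbed by ι (p − 1) = −1.
  ι-invertible : ∀ d → 0 < d → d < p → ∃[ c ] (ι c · ι d ≡ 𝟙)
  ι-invertible d 0<d d<p with coprime-Bézout (prime⇒coprime p-prime {{>-nonZero 0<d}} d<p)
  ... | Bézout.-+ x y 1+xp≡yd = y , (begin
    ι y · ι d          ≡⟨ ι-* y d ⟨
    ι (y * d)          ≡⟨ cong ι 1+xp≡yd ⟨
    ι (1 + x * p)      ≡⟨ ι[1+multiple]≡𝟙 x ⟩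
    𝟙                  ∎)
  ... | Bézout.+- x y 1+yd≡xp = (p ∸ 1) * y , (begin
    ι ((p ∸ 1) * y) · ι d       ≡⟨ cong (_· ι d) (ι-* (p ∸ 1) y) ⟩
    ι (p ∸ 1) · ι y · ι d       ≡⟨ *-assoc (ι (p ∸ 1)) (ι y) (ι d) ⟩
    ι (p ∸ 1) · (ι y · ι d)     ≡⟨ cong₂ _·_ ι[p∸1]≡-𝟙 ιyd≡-𝟙 ⟩
    ⊖ 𝟙 · ⊖ 𝟙                   ≡⟨ solve 1 (λ one → :- one :* :- one := one :* one) refl 𝟙 ⟩
    𝟙 · 𝟙                       ≡⟨ *-identityˡ 𝟙 ⟩
    𝟙                           ∎)
    where
    ιyd≡-𝟙 : ι y · ι d ≡ ⊖ 𝟙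
    ιyd≡-𝟙 = begin
      ι y · ι d                     ≡⟨ solve 2 (λ a one → a := (one :+ a) :- one) refl (ι y · ι d) 𝟙 ⟩
      (𝟙 ⊕ ι y · ι d) − 𝟙           ≡⟨ cong (λ z → (𝟙 ⊕ z) − 𝟙) (ι-* y d) ⟨
      ι (1 + y * d) − 𝟙             ≡⟨ cong (λ n → ι n − 𝟙) 1+yd≡xp ⟩
      ι (x * p) − 𝟙                 ≡⟨ cong (_− 𝟙) (ι-multiple x) ⟩
      𝟘 − 𝟙                         ≡⟨ +-identityˡ (⊖ 𝟙) ⟩
      ⊖ 𝟙                           ∎

  residue : ℕ → Fin p
  residue n = fromℕ< (m%n<n n p)

  ι-residue : ∀ n → ι (toℕ (residue n)) ≡ ι n
  ι-residue n = trans (cong ι (toℕ-fromℕ< (m%n<n n p))) (ι-mod n)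

  -- Subspaces over the prime field {ι n}.
  record Subspace : Set₁ where
    field
      _∈V : Fin q → Set
      _∈V? : Decidable _∈V
      𝟘∈V : 𝟘 ∈V
      ⊕-closed : ∀ {x y} → x ∈V → y ∈V → (x ⊕ y) ∈V
      ι·-closed : ∀ n {x} → x ∈V → (ι n · x) ∈V

    ⊖-closed : ∀ {x} → x ∈V → (⊖ x) ∈V
    ⊖-closed {x} x∈V = subst _∈V (trans (cong (_· x) ι[p∸1]≡-𝟙) (-1*x≈-x x)) (ι·-closed (p ∸ 1) x∈V)

    −-closed : ∀ {x y} → x ∈V → y ∈V → (x − y) ∈V
    −-closed x∈V y∈V = ⊕-closed x∈V (⊖-closed y∈V)

    size : ℕ
    size = count _∈V?


  module Extension (V : Subspace) (v : Fin q) (v∉V : ¬ Subspace._∈V V v) where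
    open Subspace V

    InCoset : Fin p → Fin q → Set
    InCoset i x = (x − ι (toℕ i) · v) ∈V

    InCoset? : ∀ i → Decidable (InCoset i)
    InCoset? i x = (x − ι (toℕ i) · v) ∈V?

    ι·v∉V : ∀ d → 0 < d → d < p → ¬ (ι d · v) ∈V
    ι·v∉V d 0<d d<p ιd·v∈V with ι-invertible d 0<d d<p
    ... | c , ιc·ιd≡𝟙 = v∉V (subst _∈V ιc·[ιd·v]≡v (ι·-closed c ιd·v∈V))
      where
      ιc·[ιd·v]≡v : ι c · (ι d · v) ≡ v
      ιc·[ιd·v]≡v = trans (sym (*-assoc (ι c) (ι d) v)) (trans (cong (_· v) ιc·ιd≡𝟙) (*-identityˡ v))

    coset-difference : ∀ x {a b} → a ≤ b → (x − ι a · v) − (x − ι b · v) ≡ ι (b ∸ a) · v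
    coset-difference x {a} {b} a≤b = begin
      (x − ι a · v) − (x − ι b · v)              ≡⟨ cong (λ n → (x − ι a · v) − (x − ι n · v)) (ℕ.m+[n∸m]≡n a≤b) ⟨
      (x − ι a · v) − (x − ι (a + d) · v)        ≡⟨ cong (λ y → (x − ι a · v) − (x − y · v)) (ι-+ a d) ⟩
      (x − ι a · v) − (x − (ι a ⊕ ι d) · v)      ≡⟨ solve 4 (λ x a d v → (x :- a :* v) :- (x :- (a :+ d) :* v) := d :* v) refl x (ι a) (ι d) v ⟩
      ι d · v                                    ∎
      where d = b ∸ a

    distinct-cosets : ∀ x i j → toℕ i < toℕ j → InCoset i x → InCoset j x → ⊥
    distinct-cosets x i j i<j x∈i x∈j =
      ι·v∉V (toℕ j ∸ toℕ i) (ℕ.m<n⇒0<n∸m i<j) (ℕ.≤-<-trans (ℕ.m∸n≤m (toℕ j) (toℕ i)) (toℕ<n j))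
        (subst _∈V (coset-difference x (ℕ.<⇒≤ i<j)) (−-closed x∈i x∈j))

    cosets-disjoint : ∀ x i j → InCoset i x → InCoset j x → i ≡ j
    cosets-disjoint x i j x∈i x∈j with ℕ.<-cmp (toℕ i) (toℕ j)
    ... | tri≈ _ i≡j _ = toℕ-injective i≡j
    ... | tri< i<j _ _ = ⊥-elim (distinct-cosets x i j i<j x∈i x∈j)
    ... | tri> _ _ j<i = ⊥-elim (distinct-cosets x j i j<i x∈j x∈i)

    _∈V′ : Fin q → Set
    x ∈V′ = ∃[ i ] InCoset i x

    _∈V′? : Decidable _∈V′
    x ∈V′? = any? (λ i → InCoset? i x)

    size-V′ : count _∈V′? ≡ p * size
    size-V′ = begin
      count _∈V′?                             ≡⟨ count-∃-disjoint InCoset? cosets-disjoint ⟩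
      sum (λ i → count (InCoset? i))          ≡⟨ sum-cong-≗ {p} (λ i → count-translate _∈V? (ι (toℕ i) · v)) ⟩
      sum {p} (λ _ → size)                    ≡⟨ sum-const {p} size ⟩
      p * size                                ∎

    𝟘∈V′ : 𝟘 ∈V′
    𝟘∈V′ = residue 0 , subst _∈V 𝟘≡𝟘−ι0·v 𝟘∈V
      where
      𝟘≡𝟘−ι0·v : 𝟘 ≡ 𝟘 − ι (toℕ (residue 0)) · v
      𝟘≡𝟘−ι0·v = begin
        𝟘                               ≡⟨ x−x≡𝟘 𝟘 ⟨
        𝟘 − 𝟘                           ≡⟨ cong (𝟘 −_) (zeroˡ v) ⟨
        𝟘 − 𝟘 · v                       ≡⟨ cong (λ z → 𝟘 − z · v) (ι-residue 0) ⟨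
        𝟘 − ι (toℕ (residue 0)) · v     ∎

    ⊕-closed′ : ∀ {x y} → x ∈V′ → y ∈V′ → (x ⊕ y) ∈V′
    ⊕-closed′ {x} {y} (i , x∈i) (j , y∈j) = residue (toℕ i + toℕ j) , subst _∈V eq (⊕-closed x∈i y∈j)
      where
      eq : (x − ι (toℕ i) · v) ⊕ (y − ι (toℕ j) · v) ≡ (x ⊕ y) − ι (toℕ (residue (toℕ i + toℕ j))) · v
      eq = begin
        (x − ι (toℕ i) · v) ⊕ (y − ι (toℕ j) · v)
          ≡⟨ solve 5 (λ x y a b v → (x :- a :* v) :+ (y :- b :* v) := (x :+ y) :- (a :+ b) :* v) refl x y (ι (toℕ i)) (ι (toℕ j)) v ⟩
        (x ⊕ y) − (ι (toℕ i) ⊕ ι (toℕ j)) · v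
          ≡⟨ cong (λ z → (x ⊕ y) − z · v) (trans (sym (ι-+ (toℕ i) (toℕ j))) (sym (ι-residue _))) ⟩
        (x ⊕ y) − ι (toℕ (residue (toℕ i + toℕ j))) · v    ∎

    ι·-closed′ : ∀ n {x} → x ∈V′ → (ι n · x) ∈V′
    ι·-closed′ n {x} (i , x∈i) = residue (n * toℕ i) , subst _∈V eq (ι·-closed n x∈i)
      where
      eq : ι n · (x − ι (toℕ i) · v) ≡ ι n · x − ι (toℕ (residue (n * toℕ i))) · v
      eq = begin
        ι n · (x − ι (toℕ i) · v)
          ≡⟨ solve 4 (λ c x a v → c :* (x :- a :* v) := c :* x :- (c :* a) :* v) refl (ι n) x (ι (toℕ i)) v ⟩
        ι n · x − (ι n · ι (toℕ i)) · v
          ≡⟨ cong (λ z → ι n · x − z · v) (trans (sym (ι-* n (toℕ i))) (sym (ι-residue _))) ⟩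
        ι n · x − ι (toℕ (residue (n * toℕ i))) · v    ∎

    V′ : Subspace
    V′ = record { _∈V = _∈V′ ; _∈V? = _∈V′? ; 𝟘∈V = 𝟘∈V′ ; ⊕-closed = ⊕-closed′ ; ι·-closed = ι·-closed′ }

  zeroSubspace : Subspace
  zeroSubspace = record
    { _∈V = _≡ 𝟘 ; _∈V? = _≟ 𝟘 ; 𝟘∈V = refl
    ; ⊕-closed = λ { refl refl → +-identityˡ 𝟘 }
    ; ι·-closed = λ n x≡𝟘 → trans (cong (ι n ·_) x≡𝟘) (zeroʳ (ι n)) }

  size≥1 : (V : Subspace) → 1 ≤ Subspace.size V
  size≥1 V = ℕ.≤-trans (ℕ.≤-reflexive (sym (count-single-≟ 𝟘)))
                       (count-mono (_≟ 𝟘) (Subspace._∈V? V) (λ { _ refl → Subspace.𝟘∈V V }))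

  Full : Subspace → Set
  Full V = ∀ x → Subspace._∈V V x

  -- Adjoining a vector outside V multiplies its size by p.
  large-subspace : ∀ k → ∃[ V ] ∃[ j ] (Subspace.size V ≡ p ℕ.^ j × (k ≤ Subspace.size V ⊎ Full V))
  large-subspace zero = zeroSubspace , 0 , count-single-≟ 𝟘 , inj₁ z≤n
  large-subspace (suc k) with large-subspace k
  ... | V , j , size≡pʲ , inj₂ full = V , j , size≡pʲ , inj₂ full
  ... | V , j , size≡pʲ , inj₁ k≤size with any? (λ x → ¬? (Subspace._∈V? V x))
  ...   | no ¬∃∉ = V , j , size≡pʲ , inj₂ full
    where
    full : Full V
    full x with Subspace._∈V? V x
    ... | yes x∈V = x∈V
    ... | no  x∉V = ⊥-elim (¬∃∉ (x , x∉V))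
  ...   | yes (v , v∉V) = V′ , suc j , trans size-V′ (cong (p *_) size≡pʲ) , inj₁ k<size′
    where
    open Extension V v v∉V
    k<size′ : k < Subspace.size V′
    k<size′ = ℕ.≤-<-trans k≤size (subst (Subspace.size V <_) (trans (ℕ.*-comm (Subspace.size V) p) (sym size-V′))
                (ℕ.m<m*n (Subspace.size V) p {{>-nonZero (size≥1 V)}} (ℕ.nonTrivial⇒n>1 p {{prime⇒nonTrivial p-prime}})))

  order-is-prime-power : ∃[ n ] (q ≡ p ℕ.^ n)
  order-is-prime-power with large-subspace (suc q)
  ... | V , j , size≡pʲ , inj₁ q<size = ⊥-elim (ℕ.<-irrefl refl (ℕ.<-≤-trans q<size (count≤n (Subspace._∈V? V))))
  ... | V , j , size≡pʲ , inj₂ full   = j , trans (sym (count-all (Subspace._∈V? V) full)) size≡pʲ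

module Frobenius {q : ℕ} (F : FieldOn q) where

  open import Data.Nat as ℕ using (ℕ; zero; suc; _*_; _<_; z≤n; s≤s; NonZero)
  import Data.Nat.Properties as ℕ
  open import Data.Nat.Primality using (Prime; prime⇒nonZero)
  open import Data.Nat.Combinatorics using (_C_; nCn≡1)
  open import Data.Fin using (Fin; toℕ; fromℕ; zero; suc)
  open import Data.Fin.Properties using (toℕ-fromℕ)
  open import Relation.Binary.PropositionalEquality
  open Arithmetic using (p∣pCk)

  open FieldProperties F
  open import Algebra.Properties.CommutativeSemiring.Binomial commutativeSemiring using (theorem; binomial; binomialTerm)
  open import Algebra.Properties.Monoid.Sum +-monoid using (sum)
  open ≡-Reasoning

  private
    sum-last : ∀ m (h : Fin (suc m) → Fin q) → (∀ i → toℕ i < m → h i ≡ 𝟘) → sum h ≡ h (fromℕ m)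
    sum-last zero    h _      = +-identityʳ _
    sum-last (suc m) h h≡𝟘 = begin
      h zero ⊕ sum (λ i → h (suc i))
        ≡⟨ cong₂ _⊕_ (h≡𝟘 zero (s≤s z≤n)) (sum-last m (λ i → h (suc i)) (λ i i<m → h≡𝟘 (suc i) (s≤s i<m))) ⟩
      𝟘 ⊕ h (suc (fromℕ m))            ≡⟨ +-identityˡ _ ⟩
      h (fromℕ (suc m))                ∎

  ^-additive : ∀ n → .{{NonZero n}} → (∀ k → 0 < k → k < n → ι (n C k) ≡ 𝟘) →
               ∀ x y → (x ⊕ y) ^ n ≡ x ^ n ⊕ y ^ n
  ^-additive (suc n) inner≡𝟘 x y = begin
    (x ⊕ y) ^ suc n                                                       ≡⟨ theorem (suc n) x y ⟩
    binomialTerm x y (suc n) zero ⊕ sum (λ i → binomialTerm x y (suc n) (suc i)) ≡⟨ cong₂ _⊕_ first (trans (sum-last n _ inner) (last (suc n))) ⟩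
    y ^ suc n ⊕ x ^ suc n                                                 ≡⟨ +-comm _ _ ⟩
    x ^ suc n ⊕ y ^ suc n                                                 ∎
    where
    first : binomialTerm x y (suc n) zero ≡ y ^ suc n
    first = trans (+-identityʳ _) (*-identityˡ _)
    last : ∀ m → binomialTerm x y m (fromℕ m) ≡ x ^ m
    last m rewrite toℕ-fromℕ m | nCn≡1 m | ℕ.n∸n≡0 m = trans (+-identityʳ _) (*-identityʳ _)
    inner : ∀ i → toℕ i < n → binomialTerm x y (suc n) (suc i) ≡ 𝟘
    inner i i<n = begin
      c ⋆ b        ≡⟨ ι·x≡ι⋆x c b ⟨
      ι c · b      ≡⟨ cong (_· b) (inner≡𝟘 (suc (toℕ i)) (s≤s z≤n) (s≤s i<n)) ⟩
      𝟘 · b        ≡⟨ zeroˡ b ⟩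
      𝟘            ∎
      where
      c = suc n C suc (toℕ i)
      b = binomial x y (suc n) (suc i)

  module _ {p : ℕ} (p-prime : Prime p) (ιp≡𝟘 : ι p ≡ 𝟘) where

    frobenius : ∀ x y → (x ⊕ y) ^ p ≡ x ^ p ⊕ y ^ p
    frobenius = ^-additive p {{prime⇒nonZero p-prime}} (λ k 0<k k<p → ι-∣ ιp≡𝟘 (p∣pCk p-prime 0<k k<p))

    frobenius-iterate : ∀ j x y → (x ⊕ y) ^ (p ℕ.^ j) ≡ x ^ (p ℕ.^ j) ⊕ y ^ (p ℕ.^ j)
    frobenius-iterate zero    x y = trans (*-identityʳ _) (sym (cong₂ _⊕_ (*-identityʳ x) (*-identityʳ y)))
    frobenius-iterate (suc j) x y = begin
      (x ⊕ y) ^ (p * p ℕ.^ j)                   ≡⟨ ^-assocʳ (x ⊕ y) p (p ℕ.^ j) ⟨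
      ((x ⊕ y) ^ p) ^ (p ℕ.^ j)                 ≡⟨ cong (_^ (p ℕ.^ j)) (frobenius x y) ⟩
      (x ^ p ⊕ y ^ p) ^ (p ℕ.^ j)               ≡⟨ frobenius-iterate j (x ^ p) (y ^ p) ⟩
      (x ^ p) ^ (p ℕ.^ j) ⊕ (y ^ p) ^ (p ℕ.^ j) ≡⟨ cong₂ _⊕_ (^-assocʳ x p (p ℕ.^ j)) (^-assocʳ y p (p ℕ.^ j)) ⟩
      x ^ (p * p ℕ.^ j) ⊕ y ^ (p * p ℕ.^ j)     ∎

module Fermat {q : ℕ} (F : FieldOn q) where

  open Counting
  open import Data.Nat as ℕ using (ℕ; zero; suc; _+_; _∸_; _<_; z≤n; s≤s)
  import Data.Nat.Properties as ℕ
  open import Data.Fin using (Fin; _≟_)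
  open import Data.Fin.Permutation using (permutation)
  open import Data.Empty using (⊥-elim)
  open import Relation.Nullary using (yes; no; ¬?)
  open import Relation.Binary.PropositionalEquality
  open import Function using (_∘_)

  open FieldProperties F
  open import Algebra.Properties.CommutativeMonoid.Sum *-commutativeMonoid
    using () renaming (sum to product; sum-cong-≗ to product-cong-≗; ∑-distrib-+ to product-distrib-·; sum-permute to product-permute)
  open ≡-Reasoning

  1+[q∸1]≡q : 1 + (q ∸ 1) ≡ q
  1+[q∸1]≡q = ℕ.m+[n∸m]≡n (0<n 𝟘)
    where
    0<n : ∀ {n} → Fin n → 0 < n
    0<n Fin.zero    = s≤s z≤n
    0<n (Fin.suc _) = s≤s z≤n

  count-≢𝟘 : count (¬? ∘ (_≟ 𝟘)) ≡ q ∸ 1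
  count-≢𝟘 = begin
    count (¬? ∘ (_≟ 𝟘))                          ≡⟨ ℕ.m+n∸m≡n 1 _ ⟨
    1 + count (¬? ∘ (_≟ 𝟘)) ∸ 1                  ≡⟨ cong (λ n → n + count (¬? ∘ (_≟ 𝟘)) ∸ 1) (count-single-≟ 𝟘) ⟨
    count (_≟ 𝟘) + count (¬? ∘ (_≟ 𝟘)) ∸ 1       ≡⟨ cong (_∸ 1) (count-complement (_≟ 𝟘)) ⟩
    q ∸ 1                                         ∎

  product-^ : ∀ {n} a (e : Fin n → ℕ) → product (λ x → a ^ e x) ≡ a ^ sum e
  product-^ {zero}  a e = refl
  product-^ {suc n} a e = trans (cong (a ^ e Fin.zero ·_) (product-^ a (e ∘ Fin.suc))) (sym (^-homo-* a (e Fin.zero) _))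

  private
    nonzeroPart : Fin q → Fin q
    nonzeroPart x with x ≟ 𝟘
    ... | yes _ = 𝟙
    ... | no  _ = x

    nonzeroPart≢𝟘 : ∀ x → nonzeroPart x ≢ 𝟘
    nonzeroPart≢𝟘 x with x ≟ 𝟘
    ... | yes _   = 𝟙≢𝟘
    ... | no  x≢𝟘 = x≢𝟘

    product≢𝟘 : ∀ {n} (f : Fin n → Fin q) → (∀ i → f i ≢ 𝟘) → product f ≢ 𝟘
    product≢𝟘 {zero}  f f≢𝟘 = 𝟙≢𝟘
    product≢𝟘 {suc n} f f≢𝟘 = x≢𝟘∧y≢𝟘⇒x·y≢𝟘 (f≢𝟘 Fin.zero) (product≢𝟘 (f ∘ Fin.suc) (f≢𝟘 ∘ Fin.suc))

  module _ (a : Fin q) (a≢𝟘 : a ≢ 𝟘) where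

    private
      nonzeroPart-scale : ∀ x → nonzeroPart (a · x) ≡ a ^ indicator (¬? (x ≟ 𝟘)) · nonzeroPart x
      nonzeroPart-scale x with x ≟ 𝟘 | a · x ≟ 𝟘
      ... | yes refl | yes _      = sym (*-identityˡ 𝟙)
      ... | yes refl | no  a𝟘≢𝟘   = ⊥-elim (a𝟘≢𝟘 (zeroʳ a))
      ... | no  x≢𝟘  | yes ax≡𝟘   = ⊥-elim (x≢𝟘∧y≢𝟘⇒x·y≢𝟘 a≢𝟘 x≢𝟘 ax≡𝟘)
      ... | no  x≢𝟘  | no  _      = cong (_· x) (sym (*-identityʳ a))

    -- Multiplication by a permutes the field; compare the products of the nonzero parts.
    fermat : a ^ (q ∸ 1) ≡ 𝟙
    fermat = ·-cancelʳ (product≢𝟘 nonzeroPart nonzeroPart≢𝟘) (begin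
      a ^ (q ∸ 1) · ∏                                              ≡⟨ cong (λ n → a ^ n · ∏) count-≢𝟘 ⟨
      a ^ count (¬? ∘ (_≟ 𝟘)) · ∏                                  ≡⟨ cong (_· ∏) (product-^ a (λ x → indicator (¬? (x ≟ 𝟘)))) ⟨
      product (λ x → a ^ indicator (¬? (x ≟ 𝟘))) · ∏               ≡⟨ product-distrib-· (λ x → a ^ indicator (¬? (x ≟ 𝟘))) nonzeroPart ⟨
      product (λ x → a ^ indicator (¬? (x ≟ 𝟘)) · nonzeroPart x)   ≡⟨ product-cong-≗ nonzeroPart-scale ⟨
      product (nonzeroPart ∘ (a ·_))                               ≡⟨ product-permute nonzeroPart scaling ⟨
      ∏                                                            ≡⟨ *-identityˡ ∏ ⟨
      𝟙 · ∏                                                        ∎)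
      where
      ∏ = product nonzeroPart
      scaling = permutation (a ·_) (inv a a≢𝟘 ·_) (inv-cancelʳ a a≢𝟘) (inv-cancelˡ a a≢𝟘)

  x^q≡x : ∀ x → x ^ q ≡ x
  x^q≡x x with x ≟ 𝟘
  ... | yes refl = subst (λ n → 𝟘 ^ n ≡ 𝟘) 1+[q∸1]≡q (zeroˡ _)
  ... | no  x≢𝟘  = subst (λ n → x ^ n ≡ x) 1+[q∸1]≡q (trans (cong (x ·_) (fermat x x≢𝟘)) (*-identityʳ x))

module RootBound {q : ℕ} (F : FieldOn q) where

  open Counting
  open import Data.Nat as ℕ using (ℕ; zero; suc; _+_; _≤_; z≤n; NonZero)
  import Data.Nat.Properties as ℕ
  open import Data.Fin using (Fin; _≟_)
  open import Data.Fin.Properties using (any?)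
  open import Data.Vec using (Vec; []; _∷_; replicate)
  open import Data.Product using (_,_)
  open import Data.Sum using (_⊎_; inj₁; inj₂)
  open import Relation.Nullary using (yes; no)
  open import Relation.Nullary.Decidable using (_⊎-dec_)
  open import Relation.Binary.PropositionalEquality

  open FieldProperties F

  -- The monic polynomial  c₀ + c₁ x + ⋯ + cₙ₋₁ xⁿ⁻¹ + xⁿ,  coefficients listed from c₀.
  evalMonic : ∀ {n} → Vec (Fin q) n → Fin q → Fin q
  evalMonic []       x = 𝟙
  evalMonic (c ∷ cs) x = c ⊕ x · evalMonic cs x

  -- Synthetic division by x − a.
  quotient : ∀ {n} → Vec (Fin q) (suc n) → Fin q → Vec (Fin q) n
  quotient (c ∷ [])      a = []
  quotient (c ∷ c′ ∷ cs) a = evalMonic (c′ ∷ cs) a ∷ quotient (c′ ∷ cs) a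

  factor-theorem : ∀ {n} (cs : Vec (Fin q) (suc n)) a x →
                   evalMonic cs x − evalMonic cs a ≡ (x − a) · evalMonic (quotient cs a) x
  factor-theorem (c ∷ [])      a x = solve 4 (λ c a x one → (c :+ x :* one) :- (c :+ a :* one) := (x :- a) :* one) refl c a x 𝟙
  factor-theorem (c ∷ c′ ∷ cs) a x = begin
    (c ⊕ x · fx) − (c ⊕ a · fa)            ≡⟨ cong (λ z → (c ⊕ x · z) − (c ⊕ a · fa)) fx≡ ⟩
    (c ⊕ x · (fa ⊕ (x − a) · gx)) − (c ⊕ a · fa)
      ≡⟨ solve 5 (λ c x a fa gx → (c :+ x :* (fa :+ (x :- a) :* gx)) :- (c :+ a :* fa) := (x :- a) :* (fa :+ x :* gx)) refl c x a fa gx ⟩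
    (x − a) · (fa ⊕ x · gx)                ∎
    where
    open ≡-Reasoning
    fx = evalMonic (c′ ∷ cs) x
    fa = evalMonic (c′ ∷ cs) a
    gx = evalMonic (quotient (c′ ∷ cs) a) x
    fx≡ : fx ≡ fa ⊕ (x − a) · gx
    fx≡ = trans (solve 2 (λ u v → u := v :+ (u :- v)) refl fx fa) (cong (fa ⊕_) (factor-theorem (c′ ∷ cs) a x))

  count-roots≤degree : ∀ {n} (cs : Vec (Fin q) n) → count (λ x → evalMonic cs x ≟ 𝟘) ≤ n
  count-roots≤degree [] = ℕ.≤-reflexive (count-none (λ x → evalMonic [] x ≟ 𝟘) (λ _ → 𝟙≢𝟘))
  count-roots≤degree {suc n} cs with any? (λ x → evalMonic cs x ≟ 𝟘)
  ... | no ¬∃root = ℕ.≤-trans (ℕ.≤-reflexive (count-none _ (λ x root → ¬∃root (x , root)))) z≤n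
  ... | yes (a , root-a) = begin
    count (λ x → evalMonic cs x ≟ 𝟘)                   ≤⟨ count-mono _ (λ x → (x ≟ a) ⊎-dec root-of-quotient? x) a∨quotient ⟩
    count (λ x → (x ≟ a) ⊎-dec root-of-quotient? x)    ≤⟨ count-∪ (_≟ a) root-of-quotient? ⟩
    count (_≟ a) + count root-of-quotient?             ≤⟨ ℕ.+-mono-≤ (ℕ.≤-reflexive (count-single-≟ a)) (count-roots≤degree (quotient cs a)) ⟩
    suc n                                              ∎
    where
    open ℕ.≤-Reasoning
    root-of-quotient? = λ x → evalMonic (quotient cs a) x ≟ 𝟘
    a∨quotient : ∀ x → evalMonic cs x ≡ 𝟘 → x ≡ a ⊎ evalMonic (quotient cs a) x ≡ 𝟘
    a∨quotient x root-x with x·y≡𝟘⇒x≡𝟘⊎y≡𝟘 (trans (sym (factor-theorem cs a x)) (trans (cong₂ _−_ root-x root-a) (x−x≡𝟘 𝟘)))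
    ... | inj₁ x−a≡𝟘 = inj₁ (x−y≡𝟘⇒x≡y x−a≡𝟘)
    ... | inj₂ root  = inj₂ root

  count-solutions-^ : ∀ n .{{_ : NonZero n}} c → count (λ x → x ^ n ≟ c) ≤ n
  count-solutions-^ (suc k) c = ℕ.≤-trans (count-mono _ (λ x → evalMonic cs x ≟ 𝟘) root) (count-roots≤degree cs)
    where
    cs : Vec (Fin q) (suc k)
    cs = ⊖ c ∷ replicate k 𝟘
    evalMonic-xᵏ : ∀ k x → evalMonic (replicate k 𝟘) x ≡ x ^ k
    evalMonic-xᵏ zero    x = refl
    evalMonic-xᵏ (suc k) x = trans (+-identityˡ _) (cong (x ·_) (evalMonic-xᵏ k x))
    root : ∀ x → x ^ suc k ≡ c → evalMonic cs x ≡ 𝟘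
    root x xᵏ⁺¹≡c = begin
      ⊖ c ⊕ x · evalMonic (replicate k 𝟘) x  ≡⟨ cong (λ z → ⊖ c ⊕ x · z) (evalMonic-xᵏ k x) ⟩
      ⊖ c ⊕ x ^ suc k                        ≡⟨ cong (⊖ c ⊕_) xᵏ⁺¹≡c ⟩
      ⊖ c ⊕ c                                ≡⟨ -‿inverseˡ c ⟩
      𝟘                                      ∎
      where open ≡-Reasoning

module QuadraticResidues {q : ℕ} (F : FieldOn q) (𝟙⊕𝟙≢𝟘 : FieldOn._⊕_ F (FieldOn.𝟙 F) (FieldOn.𝟙 F) ≢ FieldOn.𝟘 F) where

  open Counting
  open import Data.Nat as ℕ using (ℕ; _+_; _*_; _∸_; _≤_; NonZero)
  import Data.Nat.Properties as ℕ
  open import Data.Fin using (Fin; _≟_)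
  open import Data.Fin.Properties using (any?)
  open import Data.Product using (∃-syntax; _×_; _,_; proj₁; proj₂)
  open import Data.Sum using (_⊎_; inj₁; inj₂)
  open import Data.Empty using (⊥-elim)
  open import Relation.Nullary using (¬_; yes; no; ¬?)
  open import Relation.Nullary.Decidable using (_×-dec_; _⊎-dec_)
  open import Relation.Unary using (Decidable)
  open import Relation.Binary.PropositionalEquality
  open import Function using (_∘_)

  open FieldProperties F
  open Fermat F using (fermat; count-≢𝟘)
  open RootBound F using (count-solutions-^)

  IsSquare : Fin q → Set
  IsSquare x = ∃[ z ] (z · z ≡ x)

  IsSquare? : Decidable IsSquare
  IsSquare? x = any? (λ z → z · z ≟ x)

  NonzeroSquare : Fin q → Set
  NonzeroSquare x = x ≢ 𝟘 × IsSquare x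

  NonzeroSquare? : Decidable NonzeroSquare
  NonzeroSquare? x = ¬? (x ≟ 𝟘) ×-dec IsSquare? x

  Nonsquare : Fin q → Set
  Nonsquare x = x ≢ 𝟘 × ¬ IsSquare x

  Nonsquare? : Decidable Nonsquare
  Nonsquare? x = ¬? (x ≟ 𝟘) ×-dec ¬? (IsSquare? x)

  square-roots : ∀ {x z} → x · x ≡ z · z → x ≡ z ⊎ x ≡ ⊖ z
  square-roots {x} {z} x²≡z²
    with x·y≡𝟘⇒x≡𝟘⊎y≡𝟘 (trans [x−z][x+z]≡x²−z² (trans (cong (_− z · z) x²≡z²) (x−x≡𝟘 (z · z))))
    where
    [x−z][x+z]≡x²−z² : (x − z) · (x ⊕ z) ≡ x · x − z · z
    [x−z][x+z]≡x²−z² = solve 2 (λ x z → (x :- z) :* (x :+ z) := x :* x :- z :* z) refl x z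
  ... | inj₁ x−z≡𝟘 = inj₁ (x−y≡𝟘⇒x≡y x−z≡𝟘)
  ... | inj₂ x+z≡𝟘 = inj₂ (x−y≡𝟘⇒x≡y (trans (cong (x ⊕_) (-‿involutive z)) x+z≡𝟘))

  x≢𝟘⇒x≢-x : ∀ {x} → x ≢ 𝟘 → x ≢ ⊖ x
  x≢𝟘⇒x≢-x {x} x≢𝟘 x≡-x = x≢𝟘∧y≢𝟘⇒x·y≢𝟘 𝟙⊕𝟙≢𝟘 x≢𝟘 (begin
    (𝟙 ⊕ 𝟙) · x     ≡⟨ solve 2 (λ one x → (one :+ one) :* x := one :* x :+ one :* x) refl 𝟙 x ⟩
    𝟙 · x ⊕ 𝟙 · x   ≡⟨ cong₂ _⊕_ (*-identityˡ x) (*-identityˡ x) ⟩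
    x ⊕ x           ≡⟨ cong (_⊕ x) x≡-x ⟩
    ⊖ x ⊕ x         ≡⟨ -‿inverseˡ x ⟩
    𝟘               ∎)
    where open ≡-Reasoning

  count-square-roots : ∀ z → z ≢ 𝟘 → count (λ x → ¬? (x ≟ 𝟘) ×-dec (x · x ≟ z · z)) ≡ 2
  count-square-roots z z≢𝟘 = begin
    count (λ x → ¬? (x ≟ 𝟘) ×-dec (x · x ≟ z · z))
      ≡⟨ count-cong _ (λ x → (x ≟ z) ⊎-dec (x ≟ ⊖ z)) (λ _ → square-roots ∘ proj₂) root ⟩
    count (λ x → (x ≟ z) ⊎-dec (x ≟ ⊖ z))
      ≡⟨ count-∪-disjoint (_≟ z) (_≟ ⊖ z) (λ _ x≡z x≡-z → x≢𝟘⇒x≢-x z≢𝟘 (trans (sym x≡z) x≡-z)) ⟩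
    count (_≟ z) + count (_≟ ⊖ z)                   ≡⟨ cong₂ _+_ (count-single-≟ z) (count-single-≟ (⊖ z)) ⟩
    2                                               ∎
    where
    open ≡-Reasoning
    root : ∀ x → x ≡ z ⊎ x ≡ ⊖ z → x ≢ 𝟘 × x · x ≡ z · z
    root x (inj₁ refl) = z≢𝟘 , refl
    root x (inj₂ refl) = (λ -z≡𝟘 → z≢𝟘 (trans (sym (-‿involutive z)) (trans (cong ⊖_ -z≡𝟘) -0#≈0#)))
                       , solve 1 (λ z → :- z :* :- z := z :* z) refl z

  -- Squaring is two-to-one on nonzero elements.
  count-nonzero-squares : 2 * count NonzeroSquare? ≡ q ∸ 1
  count-nonzero-squares = sym (begin
    q ∸ 1                                                         ≡⟨ count-≢𝟘 ⟨
    count (¬? ∘ (_≟ 𝟘))                                            ≡⟨ count-fibres (¬? ∘ (_≟ 𝟘)) (λ x → x · x) ⟩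
    sum (λ y → count (λ x → ¬? (x ≟ 𝟘) ×-dec (x · x ≟ y)))         ≡⟨ sum-cong-≗ fibre ⟩
    sum (λ y → 2 * indicator (NonzeroSquare? y))                   ≡⟨ *-distribˡ-sum 2 (indicator ∘ NonzeroSquare?) ⟨
    2 * count NonzeroSquare?                                       ∎)
    where
    open ≡-Reasoning
    fibre : ∀ y → count (λ x → ¬? (x ≟ 𝟘) ×-dec (x · x ≟ y)) ≡ 2 * indicator (NonzeroSquare? y)
    fibre y with NonzeroSquare? y
    ... | yes (y≢𝟘 , z , refl) = count-square-roots z (λ z≡𝟘 → y≢𝟘 (trans (cong (_· z) z≡𝟘) (zeroˡ z)))
    ... | no ¬square = count-none (λ x → ¬? (x ≟ 𝟘) ×-dec (x · x ≟ y))
                         (λ x (x≢𝟘 , x²≡y) → ¬square ((λ y≡𝟘 → x≢𝟘∧y≢𝟘⇒x·y≢𝟘 x≢𝟘 x≢𝟘 (trans x²≡y y≡𝟘)) , x , x²≡y))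

  count-nonsquares : count Nonsquare? ≡ count NonzeroSquare?
  count-nonsquares = ℕ.+-cancelˡ-≡ (count NonzeroSquare?) _ _ (begin
    count NonzeroSquare? + count Nonsquare?   ≡⟨ count-split (¬? ∘ (_≟ 𝟘)) IsSquare? ⟨
    count (¬? ∘ (_≟ 𝟘))                        ≡⟨ count-≢𝟘 ⟩
    q ∸ 1                                     ≡⟨ count-nonzero-squares ⟨
    2 * count NonzeroSquare?                  ≡⟨ cong (count NonzeroSquare? +_) (ℕ.+-identityʳ _) ⟩
    count NonzeroSquare? + count NonzeroSquare? ∎)
    where open ≡-Reasoning

  𝟙-nonzeroSquare : NonzeroSquare 𝟙
  𝟙-nonzeroSquare = 𝟙≢𝟘 , 𝟙 , *-identityˡ 𝟙

  instance
    count-nonzero-squares≢0 : NonZero (count NonzeroSquare?)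
    count-nonzero-squares≢0 = ℕ.>-nonZero (ℕ.≤-trans (ℕ.≤-reflexive (sym (count-single-≟ 𝟙)))
                                (count-mono (_≟ 𝟙) NonzeroSquare? (λ { _ refl → 𝟙-nonzeroSquare })))

  nonzeroSquare⇒euler≡𝟙 : ∀ z → NonzeroSquare z → z ^ count NonzeroSquare? ≡ 𝟙
  nonzeroSquare⇒euler≡𝟙 z (z≢𝟘 , w , refl) = begin
    (w · w) ^ s      ≡⟨ ^-distrib-* w w s ⟩
    w ^ s · w ^ s    ≡⟨ ^-homo-* w s s ⟨
    w ^ (s + s)      ≡⟨ cong (w ^_) (trans (cong (s +_) (sym (ℕ.+-identityʳ s))) count-nonzero-squares) ⟩
    w ^ (q ∸ 1)      ≡⟨ fermat w (λ w≡𝟘 → z≢𝟘 (trans (cong (_· w) w≡𝟘) (zeroˡ w))) ⟩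
    𝟙                ∎
    where
    open ≡-Reasoning
    s = count NonzeroSquare?

  -- Euler's criterion: z ^ s = 1 has at most s solutions, and the s nonzero squares are among them.
  euler≡𝟙⇒nonzeroSquare : ∀ z → z ^ count NonzeroSquare? ≡ 𝟙 → NonzeroSquare z
  euler≡𝟙⇒nonzeroSquare = ⊆∧count≥⇒⊇ NonzeroSquare? (λ z → z ^ count NonzeroSquare? ≟ 𝟙) nonzeroSquare⇒euler≡𝟙
                            (count-solutions-^ (count NonzeroSquare?) 𝟙)

  nonsquare-exists : ∃[ n ] Nonsquare n
  nonsquare-exists with any? Nonsquare?
  ... | yes ∃nonsquare = ∃nonsquare
  ... | no  ¬∃nonsquare = ⊥-elim (ℕ.≢-nonZero⁻¹ (count NonzeroSquare?)
          (trans (sym count-nonsquares) (count-none Nonsquare? (λ n n-nonsquare → ¬∃nonsquare (n , n-nonsquare)))))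

  module _ {n : Fin q} (n-nonsquare : Nonsquare n) where

    nonsquare·square : ∀ {x} → NonzeroSquare x → ¬ IsSquare (n · x)
    nonsquare·square {x} (x≢𝟘 , w , refl) (z , z²≡nw²) = proj₂ n-nonsquare (z · w⁻¹ , (begin
      (z · w⁻¹) · (z · w⁻¹)      ≡⟨ solve 2 (λ z v → (z :* v) :* (z :* v) := (z :* z) :* (v :* v)) refl z w⁻¹ ⟩
      (z · z) · (w⁻¹ · w⁻¹)      ≡⟨ cong (_· (w⁻¹ · w⁻¹)) z²≡nw² ⟩
      (n · (w · w)) · (w⁻¹ · w⁻¹) ≡⟨ solve 3 (λ n w v → (n :* (w :* w)) :* (v :* v) := n :* ((w :* v) :* (w :* v))) refl n w w⁻¹ ⟩
      n · ((w · w⁻¹) · (w · w⁻¹)) ≡⟨ cong (λ u → n · (u · u)) (inverseʳ w w≢𝟘) ⟩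
      n · (𝟙 · 𝟙)                ≡⟨ cong (n ·_) (*-identityˡ 𝟙) ⟩
      n · 𝟙                      ≡⟨ *-identityʳ n ⟩
      n                          ∎))
      where
      open ≡-Reasoning
      w≢𝟘 : w ≢ 𝟘
      w≢𝟘 w≡𝟘 = x≢𝟘 (trans (cong (_· w) w≡𝟘) (zeroˡ w))
      w⁻¹ = inv w w≢𝟘

    -- Scaling by n is a bijection, so it maps the nonsquares onto the nonzero squares.
    nonsquare·nonsquare : ∀ {x} → Nonsquare x → NonzeroSquare (n · x)
    nonsquare·nonsquare {x} = ⊆∧count≥⇒⊇ (NonzeroSquare? ∘ (n ·_)) Nonsquare? scaled-square⇒nonsquare count≥ x
      where
      n≢𝟘 = proj₁ n-nonsquare
      scaled-square⇒nonsquare : ∀ y → NonzeroSquare (n · y) → Nonsquare y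
      scaled-square⇒nonsquare y (ny≢𝟘 , ny-square) =
        y≢𝟘 , λ y-square → nonsquare·square (y≢𝟘 , y-square) ny-square
        where
        y≢𝟘 : y ≢ 𝟘
        y≢𝟘 y≡𝟘 = ny≢𝟘 (trans (cong (n ·_) y≡𝟘) (zeroʳ n))
      count≥ : count Nonsquare? ≤ count (NonzeroSquare? ∘ (n ·_))
      count≥ = ℕ.≤-reflexive (trans count-nonsquares
                 (sym (count-scale NonzeroSquare? n n≢𝟘)))

module PaleyGraph {q : ℕ} (F : FieldOn q) (𝟙⊕𝟙≢𝟘 : FieldOn._⊕_ F (FieldOn.𝟙 F) (FieldOn.𝟙 F) ≢ FieldOn.𝟘 F) where

  open Counting
  open import Data.Nat as ℕ using (ℕ; _*_; _≤_)
  import Data.Nat.Properties as ℕ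
  open import Data.Fin using (Fin; _≟_)
  open import Data.Fin.Properties using (any?)
  open import Data.Fin.Subset using (∣_∣; Subset; _∈_)
  open import Data.Fin.Subset.Properties using (_∈?_)
  open import Data.Product using (_×_; _,_; proj₁; proj₂)
  open import Data.Empty using (⊥-elim)
  open import Relation.Nullary using (Dec; yes; no)
  open import Relation.Nullary.Decidable using (_×-dec_)
  open import Relation.Unary using (Decidable)
  open import Relation.Binary.PropositionalEquality
  open import Function using (_∘_)

  open FieldProperties F
  open QuadraticResidues F 𝟙⊕𝟙≢𝟘

  -- Adjacency in Paley F unfolds to NonzeroSquare (x − y).
  open GraphProperties (Paley F) (λ x y → NonzeroSquare? (x − y)) public
    using (cliqueNumber-exists; cocliqueNumber-exists)

  -- The translates a + C (a ∈ A) are pairwise disjoint: a + c = a′ + c′ with a ≠ a′ would make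
  -- a′ − a = c − c′ a nonzero square.
  clique-coclique-bound : ∀ C A → IsClique (Paley F) C → IsCoclique (Paley F) A → ∣ C ∣ * ∣ A ∣ ≤ q
  clique-coclique-bound C A C-clique A-coclique =
    ℕ.≤-trans (ℕ.≤-reflexive ∣C∣*∣A∣≡count) (count≤n (λ x → any? (λ a → InTranslate? a x)))
    where
    open ≡-Reasoning
    InTranslate : Fin q → Fin q → Set
    InTranslate a x = a ∈ A × (x − a) ∈ C

    InTranslate? : ∀ a → Decidable (InTranslate a)
    InTranslate? a x = (a ∈? A) ×-dec ((x − a) ∈? C)

    translates-disjoint : ∀ x a a′ → InTranslate a x → InTranslate a′ x → a ≡ a′
    translates-disjoint x a a′ (a∈A , x−a∈C) (a′∈A , x−a′∈C) with a ≟ a′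
    ... | yes a≡a′ = a≡a′
    ... | no  a≢a′ = ⊥-elim (A-coclique a′ a a′∈A a∈A (a≢a′ ∘ sym) (subst NonzeroSquare difference
                              (C-clique (x − a) (x − a′) x−a∈C x−a′∈C (a≢a′ ∘ sub-cancelˡ))))
      where
      difference : (x − a) − (x − a′) ≡ a′ − a
      difference = solve 3 (λ x a a′ → (x :- a) :- (x :- a′) := a′ :- a) refl x a a′
      sub-cancelˡ : x − a ≡ x − a′ → a ≡ a′
      sub-cancelˡ x−a≡x−a′ = x−y≡𝟘⇒x≡y (trans (solve 3 (λ x a a′ → a :- a′ := (x :- a′) :- (x :- a)) refl x a a′)
                                           (trans (cong (_− (x − a)) (sym x−a≡x−a′)) (x−x≡𝟘 (x − a))))

    count-InTranslate : ∀ a → a ∈ A → count (InTranslate? a) ≡ ∣ C ∣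
    count-InTranslate a a∈A = begin
      count (InTranslate? a)        ≡⟨ count-cong (InTranslate? a) (λ x → (x − a) ∈? C) (λ _ → proj₂) (λ _ x−a∈C → a∈A , x−a∈C) ⟩
      count (λ x → (x − a) ∈? C)    ≡⟨ count-translate (_∈? C) a ⟩
      count (_∈? C)                 ≡⟨ card≡count C ⟨
      ∣ C ∣                         ∎

    count-InTranslate-indicator : ∀ a → count (InTranslate? a) ≡ ∣ C ∣ * indicator (a ∈? A)
    count-InTranslate-indicator a = by-cases (a ∈? A)
      where
      by-cases : (a∈?A : Dec (a ∈ A)) → count (InTranslate? a) ≡ ∣ C ∣ * indicator a∈?A
      by-cases (yes a∈A) = trans (count-InTranslate a a∈A) (sym (ℕ.*-identityʳ ∣ C ∣))
      by-cases (no  a∉A) = trans (count-none (InTranslate? a) (λ _ → a∉A ∘ proj₁)) (sym (ℕ.*-zeroʳ ∣ C ∣))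

    ∣C∣*∣A∣≡count : ∣ C ∣ * ∣ A ∣ ≡ count (λ x → any? (λ a → InTranslate? a x))
    ∣C∣*∣A∣≡count = sym (begin
      count (λ x → any? (λ a → InTranslate? a x))    ≡⟨ count-∃-disjoint InTranslate? translates-disjoint ⟩
      sum (λ a → count (InTranslate? a))              ≡⟨ sum-cong-≗ count-InTranslate-indicator ⟩
      sum (λ a → ∣ C ∣ * indicator (a ∈? A))          ≡⟨ *-distribˡ-sum ∣ C ∣ (λ a → indicator (a ∈? A)) ⟨
      ∣ C ∣ * count (_∈? A)                           ≡⟨ cong (∣ C ∣ *_) (card≡count A) ⟨
      ∣ C ∣ * ∣ A ∣                                   ∎)

  private
    ν : Fin q
    ν = proj₁ nonsquare-exists

    ν-nonsquare : Nonsquare ν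
    ν-nonsquare = proj₂ nonsquare-exists

    ν≢𝟘 : ν ≢ 𝟘
    ν≢𝟘 = proj₁ ν-nonsquare

    ν·-distinct : ∀ {y y′} → y ≢ y′ → ν · y ≢ ν · y′
    ν·-distinct y≢y′ = y≢y′ ∘ ·-cancelˡ ν≢𝟘

    ν·y−ν·y′ : ∀ y y′ → ν · y − ν · y′ ≡ ν · (y − y′)
    ν·y−ν·y′ = solve 3 (λ n y y′ → n :* y :- n :* y′ := n :* (y :- y′)) refl ν

  -- Multiplication by a nonsquare swaps adjacency and non-adjacency.
  scale : Subset q → Subset q
  scale S = fromDec (λ y → (ν · y) ∈? S)

  ∣scale∣ : ∀ S → ∣ scale S ∣ ≡ ∣ S ∣
  ∣scale∣ S = begin
    ∣ scale S ∣                  ≡⟨ ∣fromDec∣ (λ y → (ν · y) ∈? S) ⟩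
    count (λ y → (ν · y) ∈? S)   ≡⟨ count-scale (_∈? S) ν ν≢𝟘 ⟩
    count (_∈? S)                ≡⟨ card≡count S ⟨
    ∣ S ∣                        ∎
    where open ≡-Reasoning

  ∈scale⇒ : ∀ S y → y ∈ scale S → (ν · y) ∈ S
  ∈scale⇒ S = ∈fromDec⇒ (λ y → (ν · y) ∈? S)

  scale-clique : ∀ C → IsClique (Paley F) C → IsCoclique (Paley F) (scale C)
  scale-clique C C-clique y y′ y∈ y′∈ y≢y′ (y−y′≢𝟘 , y−y′-square) =
    nonsquare·square ν-nonsquare (y−y′≢𝟘 , y−y′-square) (subst IsSquare (ν·y−ν·y′ y y′) (proj₂ νy~νy′))
    where
    νy~νy′ = C-clique (ν · y) (ν · y′) (∈scale⇒ C y y∈) (∈scale⇒ C y′ y′∈) (ν·-distinct y≢y′)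

  scale-coclique : ∀ A → IsCoclique (Paley F) A → IsClique (Paley F) (scale A)
  scale-coclique A A-coclique y y′ y∈ y′∈ y≢y′ with IsSquare? (y − y′)
  ... | yes y−y′-square = x≢y⇒x−y≢𝟘 y≢y′ , y−y′-square
  ... | no  y−y′-nonsquare = ⊥-elim (νy≁νy′ (subst NonzeroSquare (sym (ν·y−ν·y′ y y′))
                                  (nonsquare·nonsquare ν-nonsquare (x≢y⇒x−y≢𝟘 y≢y′ , y−y′-nonsquare))))
    where
    νy≁νy′ = A-coclique (ν · y) (ν · y′) (∈scale⇒ A y y∈) (∈scale⇒ A y′ y′∈) (ν·-distinct y≢y′)

  cliqueNumber≡cocliqueNumber : ∀ {ω α} → IsCliqueNumber (Paley F) ω → IsCocliqueNumber (Paley F) α → ω ≡ α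
  cliqueNumber≡cocliqueNumber ((C , C-clique , ∣C∣≡ω) , ω-max) ((A , A-coclique , ∣A∣≡α) , α-max) = ℕ.≤-antisym
    (subst (_≤ _) (trans (∣scale∣ C) ∣C∣≡ω) (α-max (scale C) (scale-clique C C-clique)))
    (subst (_≤ _) (trans (∣scale∣ A) ∣A∣≡α) (ω-max (scale A) (scale-coclique A A-coclique)))

  cliqueNumber*cocliqueNumber≤q : ∀ {ω α} → IsCliqueNumber (Paley F) ω → IsCocliqueNumber (Paley F) α → ω * α ≤ q
  cliqueNumber*cocliqueNumber≤q ((C , C-clique , refl) , _) ((A , A-coclique , refl) , _) =
    clique-coclique-bound C A C-clique A-coclique

module SquareOrder {q : ℕ} (F : FieldOn q) (𝟙⊕𝟙≢𝟘 : FieldOn._⊕_ F (FieldOn.𝟙 F) (FieldOn.𝟙 F) ≢ FieldOn.𝟘 F)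
  {p : ℕ} (p-prime : Prime p) (ιp≡𝟘 : FieldProperties.ι F p ≡ FieldOn.𝟘 F)
  (t : ℕ) .{{_ : NonZero t}} (q≡m*m : q ≡ suc (2 * t) * suc (2 * t)) (m-power : ∃[ j ] (suc (2 * t) ≡ p ℕ.^ j)) where

  open Counting
  open import Data.Nat as ℕ using (ℕ; suc; _+_; _*_; _∸_; _≤_; NonZero)
  import Data.Nat.Properties as ℕ
  open import Data.Nat.Primality using (Prime)
  open import Data.Fin using (Fin; _≟_)
  open import Data.Fin.Properties using (any?)
  open import Data.Fin.Subset using (∣_∣; Subset)
  open import Data.Product using (∃-syntax; _×_; _,_; proj₁; proj₂)
  open import Data.Sum using (_⊎_; inj₁; inj₂)
  open import Data.Unit using (⊤; tt)
  open import Relation.Nullary using (yes; no)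
  open import Relation.Nullary.Decidable using (_⊎-dec_; _×-dec_)
  open import Relation.Unary using (Decidable)
  open import Relation.Binary.PropositionalEquality
  open import Function using (_∘_)
  open import Data.Nat.Tactic.RingSolver using (solve-∀)

  open FieldProperties F
  open Frobenius F using (frobenius-iterate)
  open Fermat F using (x^q≡x)
  open RootBound F using (count-solutions-^)
  open QuadraticResidues F 𝟙⊕𝟙≢𝟘

  m : ℕ
  m = suc (2 * t)

  instance
    2t≢0 : NonZero (2 * t)
    2t≢0 = ℕ.m*n≢0 2 t

  φ : Fin q → Fin q
  φ x = x ^ m

  φ-⊕ : ∀ x y → φ (x ⊕ y) ≡ φ x ⊕ φ y
  φ-⊕ x y = subst (λ n → (x ⊕ y) ^ n ≡ x ^ n ⊕ y ^ n) (sym (proj₂ m-power)) (frobenius-iterate p-prime ιp≡𝟘 (proj₁ m-power) x y)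

  φ-⊖ : ∀ x → φ (⊖ x) ≡ ⊖ φ x
  φ-⊖ x = begin
    φ (⊖ x)                    ≡⟨ solve 2 (λ a b → b := (a :+ b) :- a) refl (φ x) (φ (⊖ x)) ⟩
    (φ x ⊕ φ (⊖ x)) − φ x      ≡⟨ cong (_− φ x) (φ-⊕ x (⊖ x)) ⟨
    φ (x ⊕ ⊖ x) − φ x          ≡⟨ cong (λ z → φ z − φ x) (-‿inverseʳ x) ⟩
    φ 𝟘 − φ x                  ≡⟨ cong (_− φ x) (zeroˡ _) ⟩
    𝟘 − φ x                    ≡⟨ +-identityˡ _ ⟩
    ⊖ φ x                      ∎
    where open ≡-Reasoning

  φ-− : ∀ x y → φ (x − y) ≡ φ x − φ y
  φ-− x y = trans (φ-⊕ x (⊖ y)) (cong (φ x ⊕_) (φ-⊖ y))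

  φ∘φ≡id : ∀ x → φ (φ x) ≡ x
  φ∘φ≡id x = trans (^-assocʳ x m m) (trans (cong (x ^_) (sym q≡m*m)) (x^q≡x x))

  InSubfield : Fin q → Set
  InSubfield x = φ x ≡ x

  InSubfield? : Decidable InSubfield
  InSubfield? x = φ x ≟ x

  -- φ − id is additive with kernel the subfield; its nonzero values y satisfy φ y = −y.
  δ : Fin q → Fin q
  δ x = φ x − x

  δ-− : ∀ x y → δ (x − y) ≡ δ x − δ y
  δ-− x y = trans (cong (_− (x − y)) (φ-− x y))
                  (solve 4 (λ a b x y → (a :- b) :- (x :- y) := (a :- x) :- (b :- y)) refl (φ x) (φ y) x y)

  Admissible : Fin q → Set
  Admissible y = y ≡ 𝟘 ⊎ y ^ (2 * t) ≡ ⊖ 𝟙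

  Admissible? : Decidable Admissible
  Admissible? y = (y ≟ 𝟘) ⊎-dec (y ^ (2 * t) ≟ ⊖ 𝟙)

  count-admissible : count Admissible? ≤ m
  count-admissible = ℕ.≤-trans (count-∪ (_≟ 𝟘) (λ y → y ^ (2 * t) ≟ ⊖ 𝟙))
                            (ℕ.+-mono-≤ (ℕ.≤-reflexive (count-single-≟ 𝟘)) (count-solutions-^ (2 * t) (⊖ 𝟙)))

  δ-admissible : ∀ x → Admissible (δ x)
  δ-admissible x with δ x ≟ 𝟘
  ... | yes δx≡𝟘 = inj₁ δx≡𝟘
  ... | no  δx≢𝟘 = inj₂ (·-cancelˡ δx≢𝟘 (begin
    y · y ^ (2 * t)     ≡⟨⟩
    φ y                 ≡⟨ φ-− (φ x) x ⟩
    φ (φ x) − φ x       ≡⟨ cong (_− φ x) (φ∘φ≡id x) ⟩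
    x − φ x             ≡⟨ x−y≡-[y−x] x (φ x) ⟩
    ⊖ y                 ≡⟨ trans (*-comm y (⊖ 𝟙)) (-1*x≈-x y) ⟨
    y · ⊖ 𝟙             ∎))
    where
    open ≡-Reasoning
    y = δ x

  δ≡𝟘⇒InSubfield : ∀ {x} → δ x ≡ 𝟘 → InSubfield x
  δ≡𝟘⇒InSubfield = x−y≡𝟘⇒x≡y

  InSubfield⇒δ≡𝟘 : ∀ {x} → InSubfield x → δ x ≡ 𝟘
  InSubfield⇒δ≡𝟘 {x} φx≡x = trans (cong (_− x) φx≡x) (x−x≡𝟘 x)

  -- Each nonempty fibre of δ is a translate of the subfield.
  count-δ-fibre : ∀ y → count (λ x → yes tt ×-dec (δ x ≟ y)) ≤ count InSubfield? * indicator (Admissible? y)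
  count-δ-fibre y with any? (λ x → δ x ≟ y)
  ... | no ¬∃x = ℕ.≤-trans (ℕ.≤-reflexive (count-none (λ x → yes tt ×-dec (δ x ≟ y)) (λ x (_ , δx≡y) → ¬∃x (x , δx≡y)))) ℕ.z≤n
  ... | yes (x₀ , δx₀≡y) = ℕ.≤-reflexive (begin
    count (λ x → yes tt ×-dec (δ x ≟ y))         ≡⟨ count-cong (λ x → yes tt ×-dec (δ x ≟ y)) (InSubfield? ∘ (_− x₀)) fibre⊆ ⊆fibre ⟩
    count (InSubfield? ∘ (_− x₀))                ≡⟨ count-translate InSubfield? x₀ ⟩
    count InSubfield?                            ≡⟨ ℕ.*-identityʳ _ ⟨
    count InSubfield? * 1                        ≡⟨ cong (count InSubfield? *_) (indicator-yes (Admissible? y) y-admissible) ⟨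
    count InSubfield? * indicator (Admissible? y)   ∎)
    where
    open ≡-Reasoning
    y-admissible = subst Admissible δx₀≡y (δ-admissible x₀)
    fibre⊆ : ∀ x → (⊤ × δ x ≡ y) → InSubfield (x − x₀)
    fibre⊆ x (_ , δx≡y) = δ≡𝟘⇒InSubfield (trans (δ-− x x₀) (trans (cong₂ _−_ δx≡y δx₀≡y) (x−x≡𝟘 y)))
    ⊆fibre : ∀ x → InSubfield (x − x₀) → ⊤ × δ x ≡ y
    ⊆fibre x x−x₀∈K = tt , trans (x−y≡𝟘⇒x≡y (trans (sym (δ-− x x₀)) (InSubfield⇒δ≡𝟘 x−x₀∈K))) δx₀≡y

  m≤count-InSubfield : m ≤ count InSubfield?
  m≤count-InSubfield = ℕ.*-cancelʳ-≤ m (count InSubfield?) m (begin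
    m * m                                                      ≡⟨ q≡m*m ⟨
    q                                                          ≡⟨ count-all (λ (_ : Fin q) → yes tt) (λ _ → tt) ⟨
    count (λ (_ : Fin q) → yes tt)                             ≡⟨ count-fibres (λ _ → yes tt) δ ⟩
    sum (λ y → count (λ x → yes tt ×-dec (δ x ≟ y)))           ≤⟨ sum-mono count-δ-fibre ⟩
    sum (λ y → count InSubfield? * indicator (Admissible? y))     ≡⟨ *-distribˡ-sum (count InSubfield?) (indicator ∘ Admissible?) ⟨
    count InSubfield? * count Admissible?                         ≤⟨ ℕ.*-monoʳ-≤ (count InSubfield?) count-admissible ⟩
    count InSubfield? * m                                      ∎)
    where open ℕ.≤-Reasoning

  count-nonzero-squares≡ : count NonzeroSquare? ≡ 2 * t * suc t
  count-nonzero-squares≡ = ℕ.*-cancelˡ-≡ _ _ 2 (begin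
    2 * count NonzeroSquare?          ≡⟨ count-nonzero-squares ⟩
    q ∸ 1                             ≡⟨ cong (_∸ 1) (trans q≡m*m (m*m≡ t)) ⟩
    suc (2 * (2 * t * suc t)) ∸ 1     ≡⟨⟩
    2 * (2 * t * suc t)               ∎)
    where
    open ≡-Reasoning
    m*m≡ : ∀ t → suc (2 * t) * suc (2 * t) ≡ suc (2 * (2 * t * suc t))
    m*m≡ = solve-∀

  subfield : Subset q
  subfield = fromDec InSubfield?

  m≤∣subfield∣ : m ≤ ∣ subfield ∣
  m≤∣subfield∣ = ℕ.≤-trans m≤count-InSubfield (ℕ.≤-reflexive (sym (∣fromDec∣ InSubfield?)))

  -- A nonzero d in the subfield has d ^ (m − 1) = 1, and m − 1 divides (q − 1) / 2 = (m − 1)(m + 1) / 2.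
  subfield-clique : IsClique (Paley F) subfield
  subfield-clique x y x∈ y∈ x≢y = euler≡𝟙⇒nonzeroSquare d d^s≡𝟙
    where
    open ≡-Reasoning
    d = x − y
    φd≡d : φ d ≡ d
    φd≡d = trans (φ-− x y) (cong₂ _−_ (∈fromDec⇒ InSubfield? x x∈) (∈fromDec⇒ InSubfield? y y∈))
    d^2t≡𝟙 : d ^ (2 * t) ≡ 𝟙
    d^2t≡𝟙 = ·-cancelˡ (x≢y⇒x−y≢𝟘 x≢y) (trans φd≡d (sym (*-identityʳ d)))
    d^s≡𝟙 : d ^ count NonzeroSquare? ≡ 𝟙
    d^s≡𝟙 = begin
      d ^ count NonzeroSquare?      ≡⟨ cong (d ^_) count-nonzero-squares≡ ⟩
      d ^ (2 * t * suc t)           ≡⟨ ^-assocʳ d (2 * t) (suc t) ⟨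
      (d ^ (2 * t)) ^ suc t         ≡⟨ cong (_^ suc t) d^2t≡𝟙 ⟩
      𝟙 ^ suc t                     ≡⟨ 𝟙^n≡𝟙 (suc t) ⟩
      𝟙                             ∎

module PaleySeparation {q : ℕ} (F : FieldOn q) (q-odd : q % 2 ≡ 1) where

  open import Data.Nat as ℕ using (zero; suc; _*_; _/_; _≤_)
  import Data.Nat.Properties as ℕ
  open import Data.Nat.DivMod using (m*n%n≡0)
  open import Data.Nat.Divisibility using (divides)
  open import Data.Nat.Primality using (prime[2])
  open import Data.Fin using (Fin)
  open import Data.Fin.Subset using (∣_∣)
  open import Data.Product using (∃-syntax; _×_; _,_; proj₂)
  open import Data.Empty using (⊥-elim)
  open import Relation.Binary.PropositionalEquality using (_≢_; refl; sym; trans; cong; subst)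
  open Arithmetic using (divisor-of-prime-power; odd⇒≡1+2*; square-odd⇒odd)

  open FieldProperties F
  open Characteristic F using (characteristic)
  open PrimePowerOrder F using (order-is-prime-power)

  q≢1 : q ≢ 1
  q≢1 refl = 𝟙≢𝟘 (all-equal 𝟙 𝟘)
    where
    all-equal : (x y : Fin 1) → x ≡ y
    all-equal Fin.zero Fin.zero = refl

  -- In characteristic 2 the order would be a power of 2.
  𝟙⊕𝟙≢𝟘 : 𝟙 ⊕ 𝟙 ≢ 𝟘
  𝟙⊕𝟙≢𝟘 𝟙⊕𝟙≡𝟘 with order-is-prime-power prime[2] (trans (cong (𝟙 ⊕_) ι-1) 𝟙⊕𝟙≡𝟘)
  ... | zero  , q≡1    = q≢1 q≡1
  ... | suc n , q≡2ⁿ⁺¹ = 0≢1 (trans (sym q%2≡0) q-odd)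
    where
    0≢1 : 0 ≢ 1
    0≢1 ()
    q%2≡0 : q % 2 ≡ 0
    q%2≡0 = trans (cong (_% 2) (trans q≡2ⁿ⁺¹ (ℕ.*-comm 2 (2 ℕ.^ n)))) (m*n%n≡0 (2 ℕ.^ n) 2)

  open PaleyGraph F 𝟙⊕𝟙≢𝟘

  square-order⇒large-clique : ∀ {p} → Prime p → ι p ≡ 𝟘 → ∀ m → m * m ≡ q → ∃[ C ] (IsClique (Paley F) C × m ≤ ∣ C ∣)
  square-order⇒large-clique {p} p-prime ιp≡𝟘 m m*m≡q =
    from-odd-root m (m / 2) (odd⇒≡1+2* m (square-odd⇒odd m (trans (cong (_% 2) m*m≡q) q-odd))) m*m≡q
    where
    from-odd-root : ∀ m t → m ≡ suc (2 * t) → m * m ≡ q → ∃[ C ] (IsClique (Paley F) C × m ≤ ∣ C ∣)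
    from-odd-root m zero    refl 1≡q = ⊥-elim (q≢1 (sym 1≡q))
    from-odd-root m (suc t) refl m*m≡q with order-is-prime-power p-prime ιp≡𝟘
    ... | n , q≡pⁿ = subfield , subfield-clique , m≤∣subfield∣
      where
      open SquareOrder F 𝟙⊕𝟙≢𝟘 p-prime ιp≡𝟘 (suc t) (sym m*m≡q)
             (divisor-of-prime-power p-prime n m (divides m (sym (trans m*m≡q q≡pⁿ))))

  nonsquare-order⇒separating : ¬ IsPerfectSquare q → Separating (Paley F)
  nonsquare-order⇒separating q-nonsquare with cliqueNumber-exists | cocliqueNumber-exists
  ... | ω , ω-number | α , α-number = ω , α , ω-number , α-number ,
        ℕ.≤∧≢⇒< (cliqueNumber*cocliqueNumber≤q ω-number α-number)
                (λ ω*α≡q → q-nonsquare (ω , trans (cong (ω *_) (cliqueNumber≡cocliqueNumber ω-number α-number)) ω*α≡q))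

  square-order⇒¬separating : IsPerfectSquare q → ¬ Separating (Paley F)
  square-order⇒¬separating (m , m*m≡q) (ω , α , ω-number , α-number , ω*α<q)
    with characteristic
  ... | p , p-prime , ιp≡𝟘 with square-order⇒large-clique p-prime ιp≡𝟘 m m*m≡q
  ... | C , C-clique , m≤∣C∣ = ℕ.<-irrefl refl (ℕ.<-≤-trans ω*α<q (begin
    q        ≡⟨ m*m≡q ⟨
    m * m    ≤⟨ ℕ.*-mono-≤ m≤ω (subst (m ≤_) (cliqueNumber≡cocliqueNumber ω-number α-number) m≤ω) ⟩
    ω * α    ∎))
    where
    open ℕ.≤-Reasoning
    m≤ω = ℕ.≤-trans m≤∣C∣ (proj₂ ω-number C C-clique)

lemma3p4 : (q : ℕ) (F : FieldOn q) → q % 4 ≡ 1 →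
             Separating (Paley F) ⇔ (¬ IsPerfectSquare q)
lemma3p4 q F q%4≡1 = mk⇔ (λ separating q-square → square-order⇒¬separating q-square separating) nonsquare-order⇒separating
  where
  open Arithmetic using (q%4≡1⇒q%2≡1)
  open PaleySeparation F (q%4≡1⇒q%2≡1 q q%4≡1)
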